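{- Let $k$ be a positive integer and $\ell\ge2$. For $n\ge1$ let $f_{\ell-1}(n)$ be the number of lattice paths from $(0,0)$ to $(\ell n-\ell+1,kn)$ with steps $N=(0,1)$, $E=(1,0)$ that never go above $(N^kE^\ell)^{n-1}N^kE$, with $f_{\ell-1}(0)=1$, and let $F_{\ell-1}(x)=\sum_{n\ge0}f_{\ell-1}(n)x^n$. Let $w_1,\dots,w_\ell$ be the roots of $(w-1)^\ell-xw^{k+\ell}=0$ that are fractional power series. Then $$F_{\ell-1}(x)=1+\left(\ell-1-\sum_{i=1}^{\ell}\frac{1}{1-w_i}\right)\prod_{i=1}^{\ell}(1-w_i).$$
   Context: Fractional power series are elements $\sum_{n\ge0}a_nx^{n/M}$ of the field $\mathbb{C}^{\text{fra}}((x))$ of fractional Laurent series; exactly $\ell$ of the $k+\ell$ roots of $(w-1)^\ell-xw^{k+\ell}$ in this field are fractional power series (Puiseux), each with constant term $1$. "Never goes above" means weakly below at every point. -}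

module Defs where

open import Level using (Level)
open import Algebra.Bundles using (CommutativeRing)
open import Data.Nat using (ℕ; zero; suc; _≤_; _≤?_; NonZero) renaming (_+_ to _+ℕ_; _*_ to _*ℕ_; _∸_ to _∸ℕ_)
open import Data.Nat.DivMod using (_/_; _%_)
open import Data.Fin using (Fin; toℕ) renaming (zero to fzero; suc to fsuc)
open import Data.Fin using () renaming (_≟_ to _≟F_)
open import Data.List using (List; []; _∷_; _++_; map; length; filter; replicate; concat)
open import Data.List.Relation.Unary.All using (All; all?)
open import Data.List.Relation.Unary.Any using (Any; any?)
open import Data.Product using (_×_; _,_; ∃)
open import Relation.Nullary using (Dec; ¬_; yes; no)
open import Relation.Nullary.Decidable using (_×-dec_)
open import Relation.Binary.PropositionalEquality using (_≡_)
import Data.Nat as ℕ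

data Step : Set where
  N E : Step

points : ℕ × ℕ → List Step → List (ℕ × ℕ)
points p [] = p ∷ []
points (a , b) (N ∷ s) = (a , b) ∷ points (a , suc b) s
points (a , b) (E ∷ s) = (a , b) ∷ points (suc a , b) s

WeaklyBelowPt : List Step → ℕ × ℕ → Set
WeaklyBelowPt B (a , b) = Any (λ q → (a ≡ Data.Product.proj₁ q) × (b ≤ Data.Product.proj₂ q)) (points (0 , 0) B)

NeverAbove : List Step → List Step → Set
NeverAbove P B = All (WeaklyBelowPt B) (points (0 , 0) P)

neverAbove? : (P B : List Step) → Dec (NeverAbove P B)
neverAbove? P B = all? (λ { (a , b) → any? (λ { (a' , b') → (a ℕ.≟ a') ×-dec (b ≤? b') }) (points (0 , 0) B) }) (points (0 , 0) P)

allPaths : ℕ → ℕ → List (List Step)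
allPaths zero zero = [] ∷ []
allPaths (suc e) zero = map (E ∷_) (allPaths e zero)
allPaths zero (suc m) = map (N ∷_) (allPaths zero m)
allPaths (suc e) (suc m) = map (E ∷_) (allPaths e (suc m)) ++ map (N ∷_) (allPaths (suc e) m)

boundary : (k ℓ n : ℕ) → List Step
boundary k ℓ n = concat (replicate (n ∸ℕ 1) (replicate k N ++ replicate ℓ E)) ++ replicate k N ++ (E ∷ [])

f : (k ℓ : ℕ) → ℕ → ℕ
f k ℓ zero = 1
f k ℓ (suc n) =
  length (filter (λ P → neverAbove? P (boundary k ℓ (suc n)))
                 (allPaths ((ℓ *ℕ suc n ∸ℕ ℓ) +ℕ 1) (k *ℕ suc n)))

module _ {c ℓr : Level} (R : CommutativeRing c ℓr) where
  open CommutativeRing R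

  natR : ℕ → Carrier
  natR zero = 0#
  natR (suc n) = 1# + natR n

  powR : Carrier → ℕ → Carrier
  powR x zero = 1#
  powR x (suc n) = x * powR x n

  sumFin : (n : ℕ) → (Fin n → Carrier) → Carrier
  sumFin zero g = 0#
  sumFin (suc n) g = g fzero + sumFin n (λ i → g (fsuc i))

  prodFin : (n : ℕ) → (Fin n → Carrier) → Carrier
  prodFin zero g = 1#
  prodFin (suc n) g = g fzero * prodFin n (λ i → g (fsuc i))

  IsFieldR : Set (c Level.⊔ ℓr)
  IsFieldR = (¬ (1# ≈ 0#)) × (∀ x → ¬ (x ≈ 0#) → ∃ λ y → (x * y) ≈ 1#)

  CharZero : Set ℓr
  CharZero = ∀ n → ¬ (natR (suc n) ≈ 0#)

  AlgClosed : Set (c Level.⊔ ℓr)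
  AlgClosed = ∀ n (cs : Fin (suc n) → Carrier) →
    ∃ λ r → (powR r (suc n) + sumFin (suc n) (λ i → cs i * powR r (toℕ i))) ≈ 0#

  -- Formal power series over R in a variable t (coefficient sequences).
  -- A fractional power series Σ a_n x^(n/M) is a power series in t = x^(1/M).

  PS : Set c
  PS = ℕ → Carrier

  _≈ₛ_ : PS → PS → Set ℓr
  a ≈ₛ b = ∀ n → a n ≈ b n

  constₛ : Carrier → PS
  constₛ r zero = r
  constₛ r (suc n) = 0#

  _+ₛ_ : PS → PS → PS
  (a +ₛ b) n = a n + b n

  -ₛ_ : PS → PS
  (-ₛ a) n = - (a n)

  _-ₛ_ : PS → PS → PS
  a -ₛ b = a +ₛ (-ₛ b)

  _*ₛ_ : PS → PS → PS
  (a *ₛ b) n = sumFin (suc n) (λ i → a (toℕ i) * b (n ∸ℕ toℕ i))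

  powₛ : PS → ℕ → PS
  powₛ a zero = constₛ 1#
  powₛ a (suc n) = a *ₛ powₛ a n

  sumₛ : (n : ℕ) → (Fin n → PS) → PS
  sumₛ zero g = constₛ 0#
  sumₛ (suc n) g = g fzero +ₛ sumₛ n (λ i → g (fsuc i))

  prodₛ : (n : ℕ) → (Fin n → PS) → PS
  prodₛ zero g = constₛ 1#
  prodₛ (suc n) g = g fzero *ₛ prodₛ n (λ i → g (fsuc i))

  monoₛ : ℕ → PS
  monoₛ m n with m ℕ.≟ n
  ... | yes _ = 1#
  ... | no _ = 0#

  xₛ : (M : ℕ) → PS
  xₛ M = monoₛ M

  -- a power series Σ_n g(n) x^n in x, viewed in R[[t]] with x = t^M
  inXₛ : (M : ℕ) .{{_ : NonZero M}} → (ℕ → ℕ) → PS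
  inXₛ M g m with m % M
  ... | zero = natR (g (m / M))
  ... | suc _ = 0#

  IsRoot : (k ℓ M : ℕ) → PS → Set ℓr
  IsRoot k ℓ M w = powₛ (w -ₛ constₛ 1#) ℓ ≈ₛ (xₛ M *ₛ powₛ w (k +ℕ ℓ))

  Fₛ : (k ℓ M : ℕ) .{{_ : NonZero M}} → PS
  Fₛ k ℓ M = inXₛ M (f k ℓ)

  -- Right-hand side 1 + (ℓ - 1 - Σ_i 1/(1-w_i)) Π_i (1-w_i), written with the
  -- division cleared: (Σ_i 1/(1-w_i)) Π_j (1-w_j) = Σ_i Π_{j≠i} (1-w_j).
  RHS : (ℓ : ℕ) → (Fin ℓ → PS) → PS
  RHS ℓ w =
    (constₛ 1# +ₛ (constₛ (natR (ℓ ∸ℕ 1)) *ₛ prodₛ ℓ (λ j → constₛ 1# -ₛ w j)))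
      -ₛ sumₛ ℓ (λ i → prodₛ ℓ (λ j → omit i j))
    where
      omit : Fin ℓ → Fin ℓ → PS
      omit i j with i ≟F j
      ... | yes _ = constₛ 1#
      ... | no _ = constₛ 1# -ₛ w j

{-# OPTIONS --safe #-}
module Submission where

-- Cut an admissible path at the columns j ℓ. The numbers of admissible paths entering column j ℓ at
-- each depth below the boundary evolve linearly (ℓ suffix-sum steps, then a shift by k), which gives
-- f(n+1) = c(n,1), where c(j,i) is the sum of the i-th iterated suffix sums of the entries of column
-- j ℓ; hence F = 1 + x a₁ with aᵢ = Σⱼ c(j,i) xʲ. Telescoping the same transfer shows that for every
-- root w of (w - 1)^ℓ = x w^(k+ℓ), z = w - 1 is a root of the monic polynomial
-- Z^ℓ - x Σ_{i<ℓ} (1 + Z)^(ℓ-1-i) Zⁱ aᵢ. Vieta's formulas for its two lowest coefficients give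
-- Π (1 - wᵢ) = - x a₀ and Σᵢ Π_{j≠i} (1 - wⱼ) = - x ((ℓ - 1) a₀ + a₁), so the right-hand side is 1 + x a₁.
-- Constructively, Vieta needs the differences of distinct roots to be cancellable. With t = x^(1/M),
-- the Euler operator t d/dt shows that w - 1 = tᵐ y with M = m ℓ and y₀ a unit, and in characteristic 0
-- y₀ determines w; so w - w′ = tᵐ (y - y′) with y₀ - y′₀ a unit.

open import Defs
open import Level using (Level; _⊔_)
open import Algebra.Bundles using (CommutativeRing; RawRing)
open import Algebra.Structures using (IsCommutativeRing)
open import Data.Nat using (ℕ; zero; suc; _≤_; NonZero; z≤n; s≤s)
open import Data.Nat.Divisibility using (_∣_; _∣?_; divides)
open import Data.Nat.GeneralisedArithmetic using (fold)
open import Data.Nat.ListAction using () renaming (sum to sumℕ)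
open import Data.Fin using (Fin; toℕ; _≟_) renaming (zero to fzero; suc to fsuc)
open import Data.List using (List; []; _∷_; _++_; replicate)
open import Data.Product using (Σ; ∃; _,_; proj₁; proj₂)
open import Data.Sum using (inj₁; inj₂)
open import Relation.Nullary using (¬_; yes; no; contradiction)
open import Relation.Binary.Definitions using (tri<; tri≈; tri>)
open import Relation.Binary.PropositionalEquality using (_≡_)
import Data.Nat as ℕ
import Data.Nat.Properties as ℕ
import Relation.Binary.PropositionalEquality as ≡
import Relation.Binary.Reasoning.Setoid
import Algebra.Properties.Monoid.Sum
import Data.Vec

module LatticePathCounting where
  open import Data.Nat using (ℕ; zero; suc; _+_; _*_; _∸_; _/_; _%_; _≤_; _<_; _≤?_; z≤n; s≤s)
  open import Data.Nat.ListAction using (sum)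
  open import Data.List using (List; []; _∷_; _++_; map; length; filter; replicate; concat)
  open import Data.List.Properties using (filter-none; filter-≐; filter-++; length-++)
  open import Data.List.Relation.Unary.All as All using (All; all?; []; _∷_)
  open import Data.List.Relation.Unary.Any as Any using (Any; here; there)
  open import Data.List.Membership.Propositional using (_∈_; find)
  open import Data.Product using (_×_)
  open import Relation.Nullary.Decidable using (_×-dec_)
  open import Relation.Unary using (Decidable)
  open import Relation.Binary.PropositionalEquality using (refl; cong; cong₂; sym; trans; subst; module ≡-Reasoning)

  suffixSums : List ℕ → List ℕ
  suffixSums [] = []
  suffixSums (p ∷ ps) = (p + sum ps) ∷ suffixSums ps

  -- entry s counts the admissible paths from the origin that enter column j ℓ at depth s
  -- below its ceiling (for j = 0: the origin itself, at depth k)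
  columnEntries : (k ℓ j : ℕ) → List ℕ
  columnEntries k ℓ zero = replicate k 0 ++ 1 ∷ []
  columnEntries k ℓ (suc j) = replicate k 0 ++ fold (columnEntries k ℓ j) suffixSums ℓ

  length-suffixSums : ∀ p → length (suffixSums p) ≡ length p
  length-suffixSums [] = refl
  length-suffixSums (x ∷ p) = cong suc (length-suffixSums p)

  length-fold-suffixSums : ∀ r p → length (fold p suffixSums r) ≡ length p
  length-fold-suffixSums zero p = refl
  length-fold-suffixSums (suc r) p = trans (length-suffixSums (fold p suffixSums r)) (length-fold-suffixSums r p)

  length-pad : ∀ k p → length (replicate k 0 ++ p) ≡ k + length p
  length-pad zero p = refl
  length-pad (suc k) p = cong suc (length-pad k p)

  dot : List ℕ → (ℕ → ℕ) → ℕ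
  dot [] φ = 0
  dot (x ∷ p) φ = x * φ 0 + dot p (λ s → φ (suc s))

  dot-cong : ∀ p φ ψ → (∀ s → s < length p → φ s ≡ ψ s) → dot p φ ≡ dot p ψ
  dot-cong [] φ ψ φ≗ψ = refl
  dot-cong (x ∷ p) φ ψ φ≗ψ = cong₂ (λ u v → x * u + v) (φ≗ψ 0 (s≤s z≤n)) (dot-cong p _ _ (λ s s<p → φ≗ψ (suc s) (s≤s s<p)))

  dot-const-+ : ∀ p c ψ → dot p (λ s → c + ψ s) ≡ sum p * c + dot p ψ
  dot-const-+ [] c ψ = refl
  dot-const-+ (x ∷ p) c ψ = begin
    x * (c + ψ 0) + dot p (λ s → c + ψ (suc s))
      ≡⟨ cong (x * (c + ψ 0) +_) (dot-const-+ p c (λ s → ψ (suc s))) ⟩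
    x * (c + ψ 0) + (sum p * c + dot p (λ s → ψ (suc s)))
      ≡⟨ solve 5 (λ x c y S D → x :* (c :+ y) :+ (S :* c :+ D) := (x :+ S) :* c :+ (x :* y :+ D)) refl x c (ψ 0) (sum p) _ ⟩
    (x + sum p) * c + (x * ψ 0 + dot p (λ s → ψ (suc s))) ∎
    where
    open ≡-Reasoning
    open import Data.Nat.Solver using (module +-*-Solver)
    open +-*-Solver

  partialSums : (ℕ → ℕ) → ℕ → ℕ
  partialSums φ zero = φ 0
  partialSums φ (suc s) = partialSums φ s + φ (suc s)

  partialSums-suc : ∀ φ s → partialSums φ (suc s) ≡ φ 0 + partialSums (λ d → φ (suc d)) s
  partialSums-suc φ zero = refl
  partialSums-suc φ (suc s) = trans (cong (_+ φ (suc (suc s))) (partialSums-suc φ s)) (ℕ.+-assoc (φ 0) _ _)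

  dot-partialSums : ∀ p φ → dot p (partialSums φ) ≡ dot (suffixSums p) φ
  dot-partialSums [] φ = refl
  dot-partialSums (x ∷ p) φ = begin
    x * φ 0 + dot p (λ s → partialSums φ (suc s))
      ≡⟨ cong (x * φ 0 +_) (dot-cong p _ _ (λ s _ → partialSums-suc φ s)) ⟩
    x * φ 0 + dot p (λ s → φ 0 + partialSums φ′ s)
      ≡⟨ cong (x * φ 0 +_) (dot-const-+ p (φ 0) (partialSums φ′)) ⟩
    x * φ 0 + (sum p * φ 0 + dot p (partialSums φ′))
      ≡⟨ cong (λ d → x * φ 0 + (sum p * φ 0 + d)) (dot-partialSums p φ′) ⟩
    x * φ 0 + (sum p * φ 0 + dot (suffixSums p) φ′)
      ≡⟨ ℕ.+-assoc (x * φ 0) _ _ ⟨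
    (x * φ 0 + sum p * φ 0) + dot (suffixSums p) φ′
      ≡⟨ cong (_+ dot (suffixSums p) φ′) (ℕ.*-distribʳ-+ (φ 0) x (sum p)) ⟨
    (x + sum p) * φ 0 + dot (suffixSums p) φ′ ∎
    where
    open ≡-Reasoning
    φ′ = λ d → φ (suc d)

  dot-pad : ∀ k p φ → dot (replicate k 0 ++ p) φ ≡ dot p (λ s → φ (k + s))
  dot-pad zero p φ = refl
  dot-pad (suc k) p φ = dot-pad k p (λ s → φ (suc s))

  dot-const-1 : ∀ p → dot p (λ _ → 1) ≡ sum p
  dot-const-1 [] = refl
  dot-const-1 (x ∷ p) = cong₂ _+_ (ℕ.*-identityʳ x) (dot-const-1 p)

  Point : Set
  Point = ℕ × ℕ

  endpoint : Point → List Step → Point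
  endpoint p [] = p
  endpoint (a , b) (N ∷ s) = endpoint (a , suc b) s
  endpoint (a , b) (E ∷ s) = endpoint (suc a , b) s

  endpoint-++ : ∀ p xs ys → endpoint p (xs ++ ys) ≡ endpoint (endpoint p xs) ys
  endpoint-++ p [] ys = refl
  endpoint-++ (a , b) (N ∷ xs) ys = endpoint-++ (a , suc b) xs ys
  endpoint-++ (a , b) (E ∷ xs) ys = endpoint-++ (suc a , b) xs ys

  endpoint-Nⁿ : ∀ t a b → endpoint (a , b) (replicate t N) ≡ (a , t + b)
  endpoint-Nⁿ zero a b = refl
  endpoint-Nⁿ (suc t) a b = trans (endpoint-Nⁿ t a (suc b)) (cong (a ,_) (ℕ.+-suc t b))

  endpoint-Eⁿ : ∀ t a b → endpoint (a , b) (replicate t E) ≡ (t + a , b)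
  endpoint-Eⁿ zero a b = refl
  endpoint-Eⁿ (suc t) a b = trans (endpoint-Eⁿ t (suc a) b) (cong (_, b) (ℕ.+-suc t a))

  module _ {P : Point → Set} where

    Any-points-start : ∀ p ys → P p → Any P (points p ys)
    Any-points-start p [] Pp = here Pp
    Any-points-start p (N ∷ ys) Pp = here Pp
    Any-points-start p (E ∷ ys) Pp = here Pp

    Any-points-++ˡ : ∀ p xs ys → Any P (points p xs) → Any P (points p (xs ++ ys))
    Any-points-++ˡ p [] ys (here Pp) = Any-points-start p ys Pp
    Any-points-++ˡ (a , b) (N ∷ xs) ys (here Pp) = here Pp
    Any-points-++ˡ (a , b) (N ∷ xs) ys (there any) = there (Any-points-++ˡ (a , suc b) xs ys any)
    Any-points-++ˡ (a , b) (E ∷ xs) ys (here Pp) = here Pp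
    Any-points-++ˡ (a , b) (E ∷ xs) ys (there any) = there (Any-points-++ˡ (suc a , b) xs ys any)

    Any-points-++ʳ : ∀ p xs ys → Any P (points (endpoint p xs) ys) → Any P (points p (xs ++ ys))
    Any-points-++ʳ p [] ys any = any
    Any-points-++ʳ (a , b) (N ∷ xs) ys any = there (Any-points-++ʳ (a , suc b) xs ys any)
    Any-points-++ʳ (a , b) (E ∷ xs) ys any = there (Any-points-++ʳ (suc a , b) xs ys any)

    All-points-++ : ∀ p xs ys → All P (points p xs) → All P (points (endpoint p xs) ys) → All P (points p (xs ++ ys))
    All-points-++ p [] [] (_ ∷ []) all = all
    All-points-++ p [] (N ∷ ys) (_ ∷ []) all = all
    All-points-++ p [] (E ∷ ys) (_ ∷ []) all = all
    All-points-++ (a , b) (N ∷ xs) ys (Pp ∷ all₁) all₂ = Pp ∷ All-points-++ (a , suc b) xs ys all₁ all₂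
    All-points-++ (a , b) (E ∷ xs) ys (Pp ∷ all₁) all₂ = Pp ∷ All-points-++ (suc a , b) xs ys all₁ all₂

    All-points-Nⁿ : ∀ t a b → (∀ u → u ≤ t → P (a , u + b)) → All P (points (a , b) (replicate t N))
    All-points-Nⁿ zero a b P-column = P-column 0 z≤n ∷ []
    All-points-Nⁿ (suc t) a b P-column = P-column 0 z≤n ∷ All-points-Nⁿ t a (suc b)
      (λ u u≤t → subst (λ y → P (a , y)) (sym (ℕ.+-suc u b)) (P-column (suc u) (s≤s u≤t)))

    All-points-Eⁿ : ∀ t a b → (∀ v → v ≤ t → P (v + a , b)) → All P (points (a , b) (replicate t E))
    All-points-Eⁿ zero a b P-row = P-row 0 z≤n ∷ []
    All-points-Eⁿ (suc t) a b P-row = P-row 0 z≤n ∷ All-points-Eⁿ t (suc a) b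
      (λ v v≤t → subst (λ x → P (x , b)) (sym (ℕ.+-suc v a)) (P-row (suc v) (s≤s v≤t)))

    Any-points-Nⁿ : ∀ t a b u → u ≤ t → P (a , u + b) → Any P (points (a , b) (replicate t N))
    Any-points-Nⁿ zero a b zero _ Pp = here Pp
    Any-points-Nⁿ (suc t) a b zero _ Pp = here Pp
    Any-points-Nⁿ (suc t) a b (suc u) (s≤s u≤t) Pp = there (Any-points-Nⁿ t a (suc b) u u≤t (subst (λ y → P (a , y)) (sym (ℕ.+-suc u b)) Pp))

    Any-points-Eⁿ : ∀ t a b v → v ≤ t → P (v + a , b) → Any P (points (a , b) (replicate t E))
    Any-points-Eⁿ zero a b zero _ Pp = here Pp
    Any-points-Eⁿ (suc t) a b zero _ Pp = here Pp
    Any-points-Eⁿ (suc t) a b (suc v) (s≤s v≤t) Pp = there (Any-points-Eⁿ t (suc a) b v v≤t (subst (λ x → P (x , b)) (sym (ℕ.+-suc v a)) Pp))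

  module _ {A : Set} {P : A → Set} (P? : Decidable P) where

    length-filter-map : ∀ (g : A → A) xs → length (filter P? (map g xs)) ≡ length (filter (λ x → P? (g x)) xs)
    length-filter-map g [] = refl
    length-filter-map g (x ∷ xs) with P? (g x)
    ... | yes _ = cong suc (length-filter-map g xs)
    ... | no _ = length-filter-map g xs

  module PathsInRegion {Q : Point → Set} (Q? : Decidable Q) where

    InRegion : Point → List Step → Set
    InRegion p P = All Q (points p P)

    inRegion? : ∀ p → Decidable (InRegion p)
    inRegion? p P = all? Q? (points p P)

    #paths : Point → ℕ → ℕ → ℕ
    #paths p i j = length (filter (inRegion? p) (allPaths i j))

    InRegion⇒start : ∀ p P → InRegion p P → Q p
    InRegion⇒start p [] (Qp ∷ _) = Qp
    InRegion⇒start p (N ∷ P) (Qp ∷ _) = Qp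
    InRegion⇒start p (E ∷ P) (Qp ∷ _) = Qp

    #paths-outside : ∀ p i j → ¬ Q p → #paths p i j ≡ 0
    #paths-outside p i j ¬Qp = cong length (filter-none (inRegion? p) {allPaths i j}
      (All.universal (λ P inP → ¬Qp (InRegion⇒start p P inP)) (allPaths i j)))

    #paths-after : ∀ step a b X → Q (a , b) →
      length (filter (inRegion? (a , b)) (map (step ∷_) X)) ≡ length (filter (inRegion? (endpoint (a , b) (step ∷ []))) X)
    #paths-after N a b X Qab = trans (length-filter-map (inRegion? (a , b)) (N ∷_) X)
      (cong length (filter-≐ _ (inRegion? (a , suc b)) (All.tail , (Qab ∷_)) X))
    #paths-after E a b X Qab = trans (length-filter-map (inRegion? (a , b)) (E ∷_) X)
      (cong length (filter-≐ _ (inRegion? (suc a , b)) (All.tail , (Qab ∷_)) X))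

    #paths-empty : ∀ p → Q p → #paths p 0 0 ≡ 1
    #paths-empty p Qp with Q? p
    ... | yes _ = refl
    ... | no ¬Qp = contradiction Qp ¬Qp

    #paths-E : ∀ a b i → Q (a , b) → #paths (a , b) (suc i) 0 ≡ #paths (suc a , b) i 0
    #paths-E a b i = #paths-after E a b (allPaths i 0)

    #paths-N : ∀ a b j → Q (a , b) → #paths (a , b) 0 (suc j) ≡ #paths (a , suc b) 0 j
    #paths-N a b j = #paths-after N a b (allPaths 0 j)

    #paths-EN : ∀ a b i j → Q (a , b) → #paths (a , b) (suc i) (suc j) ≡ #paths (suc a , b) i (suc j) + #paths (a , suc b) (suc i) j
    #paths-EN a b i j Qab = begin
      length (filter inRegion?′ (Es ++ Ns))
        ≡⟨ cong length (filter-++ inRegion?′ Es Ns) ⟩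
      length (filter inRegion?′ Es ++ filter inRegion?′ Ns)
        ≡⟨ length-++ (filter inRegion?′ Es) ⟩
      length (filter inRegion?′ Es) + length (filter inRegion?′ Ns)
        ≡⟨ cong₂ _+_ (#paths-after E a b (allPaths i (suc j)) Qab) (#paths-after N a b (allPaths (suc i) j) Qab) ⟩
      #paths (suc a , b) i (suc j) + #paths (a , suc b) (suc i) j ∎
      where
      open ≡-Reasoning
      inRegion?′ = inRegion? (a , b)
      Es = map (E ∷_) (allPaths i (suc j))
      Ns = map (N ∷_) (allPaths (suc i) j)

    -- column a meets the region in the heights 0 … c; a path from depth s below c climbs to
    -- some depth d ≤ s and then leaves the column
    #paths-column : ∀ a c i g → (∀ y → Q (a , y) → y ≤ c) → (∀ y → y ≤ c → Q (a , y)) →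
      ∀ s → s ≤ c → #paths (a , c ∸ s) (suc i) (s + g) ≡ partialSums (λ d → #paths (suc a , c ∸ d) i (d + g)) s
    #paths-column a c i zero _ below-c zero _ = #paths-E a c i (below-c c ℕ.≤-refl)
    #paths-column a c i (suc g) Q⇒≤c below-c zero _ = begin
      #paths (a , c) (suc i) (suc g)
        ≡⟨ #paths-EN a c i g (below-c c ℕ.≤-refl) ⟩
      #paths (suc a , c) i (suc g) + #paths (a , suc c) (suc i) g
        ≡⟨ cong (#paths (suc a , c) i (suc g) +_) (#paths-outside (a , suc c) (suc i) g (λ Q → ℕ.<-irrefl refl (Q⇒≤c (suc c) Q))) ⟩
      #paths (suc a , c) i (suc g) + 0
        ≡⟨ ℕ.+-identityʳ _ ⟩
      #paths (suc a , c) i (suc g) ∎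
      where open ≡-Reasoning
    #paths-column a c i g Q⇒≤c below-c (suc s) s<c = begin
      #paths (a , c ∸ suc s) (suc i) (suc (s + g))
        ≡⟨ #paths-EN a (c ∸ suc s) i (s + g) (below-c _ (ℕ.m∸n≤m c (suc s))) ⟩
      φ (suc s) + #paths (a , suc (c ∸ suc s)) (suc i) (s + g)
        ≡⟨ cong (λ y → φ (suc s) + #paths (a , y) (suc i) (s + g)) (ℕ.+-∸-assoc 1 s<c) ⟨
      φ (suc s) + #paths (a , c ∸ s) (suc i) (s + g)
        ≡⟨ cong (φ (suc s) +_) (#paths-column a c i g Q⇒≤c below-c s (ℕ.<⇒≤ s<c)) ⟩
      φ (suc s) + partialSums φ s
        ≡⟨ ℕ.+-comm (φ (suc s)) (partialSums φ s) ⟩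
      partialSums φ (suc s) ∎
      where
      open ≡-Reasoning
      φ = λ d → #paths (suc a , c ∸ d) i (d + g)

    #paths-last-column : ∀ a c → (∀ y → y ≤ c → Q (a , y)) → ∀ s → s ≤ c → #paths (a , c ∸ s) 0 s ≡ 1
    #paths-last-column a c below-c zero _ = #paths-empty (a , c) (below-c c ℕ.≤-refl)
    #paths-last-column a c below-c (suc s) s<c = begin
      #paths (a , c ∸ suc s) 0 (suc s)        ≡⟨ #paths-N a (c ∸ suc s) s (below-c _ (ℕ.m∸n≤m c (suc s))) ⟩
      #paths (a , suc (c ∸ suc s)) 0 s        ≡⟨ cong (λ y → #paths (a , y) 0 s) (ℕ.+-∸-assoc 1 s<c) ⟨
      #paths (a , c ∸ s) 0 s                  ≡⟨ #paths-last-column a c below-c s (ℕ.<⇒≤ s<c) ⟩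
      1                                       ∎
      where open ≡-Reasoning

  module BoundaryRegion (k ℓ₁ : ℕ) (0<ℓ₁ : 0 < ℓ₁) (n : ℕ) where
    open ≡-Reasoning
    open import Data.Nat.DivMod using (m*n/n≡m; m<n⇒m/n≡0; +-distrib-/-∣ˡ; /-monoˡ-≤)
    open import Data.Nat.Divisibility using (divides-refl)

    ℓ : ℕ
    ℓ = suc ℓ₁

    1<ℓ : 1 < ℓ
    1<ℓ = s≤s 0<ℓ₁

    e m : ℕ
    e = n * ℓ + 1
    m = k * suc n

    blockCeiling : ℕ → ℕ
    blockCeiling j = k + j * k

    -- the height of the boundary (Nᵏ Eˡ)ⁿ Nᵏ E above column a
    ceiling : ℕ → ℕ
    ceiling a = blockCeiling (a / ℓ)

    Admissible : Point → Set
    Admissible (a , b) = a ≤ e × b ≤ ceiling a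

    admissible? : Decidable Admissible
    admissible? (a , b) = (a ≤? e) ×-dec (b ≤? ceiling a)

    open PathsInRegion admissible? public

    -- admissible paths to (e , m) from depth s below the ceiling of column a
    fromDepth : ℕ → ℕ → ℕ
    fromDepth a s = #paths (a , ceiling a ∸ s) (e ∸ a) (s + (m ∸ ceiling a))

    [jℓ+r]/ℓ≡j : ∀ j r → r < ℓ → (j * ℓ + r) / ℓ ≡ j
    [jℓ+r]/ℓ≡j j r r<ℓ = begin
      (j * ℓ + r) / ℓ     ≡⟨ +-distrib-/-∣ˡ r (divides-refl j) ⟩
      j * ℓ / ℓ + r / ℓ   ≡⟨ cong₂ _+_ (m*n/n≡m j ℓ) (m<n⇒m/n≡0 r<ℓ) ⟩
      j + 0               ≡⟨ ℕ.+-identityʳ j ⟩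
      j                   ∎

    ceiling-block : ∀ j r → r < ℓ → ceiling (j * ℓ + r) ≡ blockCeiling j
    ceiling-block j r r<ℓ = cong blockCeiling ([jℓ+r]/ℓ≡j j r r<ℓ)

    ceiling-mono : ∀ {a a′} → a ≤ a′ → ceiling a ≤ ceiling a′
    ceiling-mono a≤a′ = ℕ.+-monoʳ-≤ k (ℕ.*-monoˡ-≤ k (/-monoˡ-≤ ℓ a≤a′))

    blockCeiling-suc : ∀ j → blockCeiling (suc j) ≡ blockCeiling j + k
    blockCeiling-suc j = ℕ.+-comm k (k + j * k)

    m≡blockCeiling : m ≡ blockCeiling n
    m≡blockCeiling = trans (ℕ.*-suc k n) (cong (k +_) (ℕ.*-comm k n))

    ceiling-0 : ceiling 0 ≡ k
    ceiling-0 = ℕ.+-identityʳ k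

    ceiling-e : ceiling e ≡ m
    ceiling-e = trans (ceiling-block n 1 1<ℓ) (sym m≡blockCeiling)

    length-columnEntries : ∀ j → length (columnEntries k ℓ j) ≡ suc (blockCeiling j)
    length-columnEntries zero = trans (length-pad k (1 ∷ [])) (trans (ℕ.+-comm k 1) (cong suc (sym ceiling-0)))
    length-columnEntries (suc j) = begin
      length (replicate k 0 ++ fold (columnEntries k ℓ j) suffixSums ℓ) ≡⟨ length-pad k _ ⟩
      k + length (fold (columnEntries k ℓ j) suffixSums ℓ)              ≡⟨ cong (k +_) (length-fold-suffixSums ℓ (columnEntries k ℓ j)) ⟩
      k + length (columnEntries k ℓ j)                                  ≡⟨ cong (k +_) (length-columnEntries j) ⟩
      k + suc (blockCeiling j)                                          ≡⟨ ℕ.+-suc k (blockCeiling j) ⟩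
      suc (blockCeiling (suc j))                                        ∎

    length-fold-columnEntries : ∀ j r → length (fold (columnEntries k ℓ j) suffixSums r) ≡ suc (blockCeiling j)
    length-fold-columnEntries j r = trans (length-fold-suffixSums r (columnEntries k ℓ j)) (length-columnEntries j)

    dot-fromDepth-suc : ∀ a p → a < e → length p ≡ suc (ceiling a) →
      dot p (fromDepth a) ≡ dot (suffixSums p) (λ d → #paths (suc a , ceiling a ∸ d) (e ∸ suc a) (d + (m ∸ ceiling a)))
    dot-fromDepth-suc a p a<e |p| = trans (dot-cong p _ _ climb) (dot-partialSums p _)
      where
      c = ceiling a
      climb : ∀ s → s < length p → fromDepth a s ≡ partialSums (λ d → #paths (suc a , c ∸ d) (e ∸ suc a) (d + (m ∸ c))) s
      climb s s<p = trans (cong (λ i → #paths (a , c ∸ s) i (s + (m ∸ c))) (ℕ.+-∸-assoc 1 a<e))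
        (#paths-column a c (e ∸ suc a) (m ∸ c) (λ _ → proj₂) (λ _ y≤c → ℕ.<⇒≤ a<e , y≤c) s (ℕ.≤-pred (subst (s <_) |p| s<p)))

    dot-fromDepth-level : ∀ a p → a < e → ceiling (suc a) ≡ ceiling a → length p ≡ suc (ceiling a) →
      dot p (fromDepth a) ≡ dot (suffixSums p) (fromDepth (suc a))
    dot-fromDepth-level a p a<e level |p| = trans (dot-fromDepth-suc a p a<e |p|)
      (dot-cong (suffixSums p) _ _ (λ d _ → cong (λ c → #paths (suc a , c ∸ d) (e ∸ suc a) (d + (m ∸ c))) (sym level)))

    dot-fromDepth-rise : ∀ a p → a < e → ceiling (suc a) ≡ ceiling a + k → ceiling a + k ≤ m → length p ≡ suc (ceiling a) →
      dot p (fromDepth a) ≡ dot (replicate k 0 ++ suffixSums p) (fromDepth (suc a))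
    dot-fromDepth-rise a p a<e rise c+k≤m |p| = trans (dot-fromDepth-suc a p a<e |p|)
      (trans (dot-cong (suffixSums p) _ _ deeper) (sym (dot-pad k (suffixSums p) (fromDepth (suc a)))))
      where
      c = ceiling a
      height : ∀ d → (c + k) ∸ (k + d) ≡ c ∸ d
      height d = trans (cong (_∸ (k + d)) (ℕ.+-comm c k)) (ℕ.[m+n]∸[m+o]≡n∸o k c d)
      climbs : ∀ d → (k + d) + (m ∸ (c + k)) ≡ d + (m ∸ c)
      climbs d = begin
        (k + d) + (m ∸ (c + k)) ≡⟨ cong₂ _+_ (ℕ.+-comm d k) (ℕ.∸-+-assoc m c k) ⟨
        (d + k) + ((m ∸ c) ∸ k) ≡⟨ ℕ.+-assoc d k _ ⟩
        d + (k + ((m ∸ c) ∸ k)) ≡⟨ cong (d +_) (ℕ.m+[n∸m]≡n (subst (_≤ m ∸ c) (ℕ.m+n∸m≡n c k) (ℕ.∸-monoˡ-≤ c c+k≤m))) ⟩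
        d + (m ∸ c)             ∎
      deeper : ∀ d → d < length (suffixSums p) → #paths (suc a , c ∸ d) (e ∸ suc a) (d + (m ∸ c)) ≡ fromDepth (suc a) (k + d)
      deeper d _ = sym (trans (cong (λ c′ → #paths (suc a , c′ ∸ (k + d)) (e ∸ suc a) ((k + d) + (m ∸ c′))) rise)
        (cong₂ (λ y i → #paths (suc a , y) (e ∸ suc a) i) (height d) (climbs d)))

    dot-fromDepth-within-block : ∀ j r → r < ℓ → j * ℓ + r ≤ e →
      dot (columnEntries k ℓ j) (fromDepth (j * ℓ + 0)) ≡ dot (fold (columnEntries k ℓ j) suffixSums r) (fromDepth (j * ℓ + r))
    dot-fromDepth-within-block j zero _ _ = refl
    dot-fromDepth-within-block j (suc r) r<ℓ a<e = begin
      dot (columnEntries k ℓ j) (fromDepth (j * ℓ + 0)) ≡⟨ dot-fromDepth-within-block j r (ℕ.<⇒≤ r<ℓ) (ℕ.<⇒≤ a<e′) ⟩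
      dot qʳ (fromDepth a)                              ≡⟨ dot-fromDepth-level a qʳ a<e′ level |qʳ| ⟩
      dot (suffixSums qʳ) (fromDepth (suc a))           ≡⟨ cong (λ a′ → dot (suffixSums qʳ) (fromDepth a′)) (ℕ.+-suc (j * ℓ) r) ⟨
      dot (suffixSums qʳ) (fromDepth (j * ℓ + suc r))   ∎
      where
      a = j * ℓ + r
      qʳ = fold (columnEntries k ℓ j) suffixSums r
      a<e′ : a < e
      a<e′ = subst (_≤ e) (ℕ.+-suc (j * ℓ) r) a<e
      level : ceiling (suc a) ≡ ceiling a
      level = trans (cong ceiling (sym (ℕ.+-suc (j * ℓ) r))) (trans (ceiling-block j (suc r) r<ℓ) (sym (ceiling-block j r (ℕ.<⇒≤ r<ℓ))))
      |qʳ| : length qʳ ≡ suc (ceiling a)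
      |qʳ| = trans (length-fold-columnEntries j r) (cong suc (sym (ceiling-block j r (ℕ.<⇒≤ r<ℓ))))

    dot-fromDepth-next-block : ∀ j → j < n →
      dot (columnEntries k ℓ j) (fromDepth (j * ℓ + 0)) ≡ dot (columnEntries k ℓ (suc j)) (fromDepth (suc j * ℓ + 0))
    dot-fromDepth-next-block j j<n = begin
      dot (columnEntries k ℓ j) (fromDepth (j * ℓ + 0))            ≡⟨ dot-fromDepth-within-block j ℓ₁ ℕ.≤-refl (ℕ.<⇒≤ a<e) ⟩
      dot qˡ (fromDepth a)                                         ≡⟨ dot-fromDepth-rise a qˡ a<e rise c+k≤m |qˡ| ⟩
      dot (columnEntries k ℓ (suc j)) (fromDepth (suc a))          ≡⟨ cong (λ a′ → dot (columnEntries k ℓ (suc j)) (fromDepth a′)) next ⟩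
      dot (columnEntries k ℓ (suc j)) (fromDepth (suc j * ℓ + 0))  ∎
      where
      a = j * ℓ + ℓ₁
      qˡ = fold (columnEntries k ℓ j) suffixSums ℓ₁
      next : suc a ≡ suc j * ℓ + 0
      next = trans (sym (ℕ.+-suc (j * ℓ) ℓ₁)) (trans (ℕ.+-comm (j * ℓ) ℓ) (sym (ℕ.+-identityʳ _)))
      a<e : a < e
      a<e = ℕ.≤-trans (ℕ.≤-reflexive (trans next (ℕ.+-identityʳ _))) (ℕ.≤-trans (ℕ.*-monoˡ-≤ ℓ j<n) (ℕ.m≤m+n (n * ℓ) 1))
      ceiling-a : ceiling a ≡ blockCeiling j
      ceiling-a = ceiling-block j ℓ₁ ℕ.≤-refl
      rise : ceiling (suc a) ≡ ceiling a + k
      rise = begin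
        ceiling (suc a)          ≡⟨ cong ceiling next ⟩
        ceiling (suc j * ℓ + 0)  ≡⟨ ceiling-block (suc j) 0 (s≤s z≤n) ⟩
        blockCeiling (suc j)     ≡⟨ blockCeiling-suc j ⟩
        blockCeiling j + k       ≡⟨ cong (_+ k) ceiling-a ⟨
        ceiling a + k            ∎
      c+k≤m : ceiling a + k ≤ m
      c+k≤m = subst (_≤ m) (trans (blockCeiling-suc j) (cong (_+ k) (sym ceiling-a)))
        (subst (blockCeiling (suc j) ≤_) (sym m≡blockCeiling) (ℕ.+-monoʳ-≤ k (ℕ.*-monoˡ-≤ k j<n)))
      |qˡ| : length qˡ ≡ suc (ceiling a)
      |qˡ| = trans (length-fold-columnEntries j ℓ₁) (cong suc (sym ceiling-a))

    #paths≡dot-columnEntries : ∀ j → j ≤ n → #paths (0 , 0) e m ≡ dot (columnEntries k ℓ j) (fromDepth (j * ℓ + 0))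
    #paths≡dot-columnEntries zero _ = sym (begin
      dot (replicate k 0 ++ 1 ∷ []) (fromDepth 0) ≡⟨ dot-pad k (1 ∷ []) (fromDepth 0) ⟩
      1 * fromDepth 0 (k + 0) + 0                 ≡⟨ trans (ℕ.+-identityʳ _) (ℕ.*-identityˡ _) ⟩
      fromDepth 0 (k + 0)                         ≡⟨ cong₂ (λ y i → #paths (0 , y) e i) start-height start-climb ⟩
      #paths (0 , 0) e m                          ∎)
      where
      start-height : ceiling 0 ∸ (k + 0) ≡ 0
      start-height = trans (cong₂ _∸_ ceiling-0 (ℕ.+-identityʳ k)) (ℕ.n∸n≡0 k)
      start-climb : (k + 0) + (m ∸ ceiling 0) ≡ m
      start-climb = trans (cong₂ (λ x y → x + (m ∸ y)) (ℕ.+-identityʳ k) ceiling-0)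
        (ℕ.m+[n∸m]≡n (subst (k ≤_) (sym m≡blockCeiling) (ℕ.m≤m+n k (n * k))))
    #paths≡dot-columnEntries (suc j) j<n = trans (#paths≡dot-columnEntries j (ℕ.<⇒≤ j<n)) (dot-fromDepth-next-block j j<n)

    #paths-origin : #paths (0 , 0) e m ≡ sum (suffixSums (columnEntries k ℓ n))
    #paths-origin = begin
      #paths (0 , 0) e m                                   ≡⟨ #paths≡dot-columnEntries n ℕ.≤-refl ⟩
      dot (columnEntries k ℓ n) (fromDepth (n * ℓ + 0))    ≡⟨ dot-fromDepth-within-block n 1 1<ℓ ℕ.≤-refl ⟩
      dot (suffixSums (columnEntries k ℓ n)) (fromDepth e) ≡⟨ dot-cong (suffixSums (columnEntries k ℓ n)) _ _ single ⟩
      dot (suffixSums (columnEntries k ℓ n)) (λ _ → 1)     ≡⟨ dot-const-1 (suffixSums (columnEntries k ℓ n)) ⟩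
      sum (suffixSums (columnEntries k ℓ n))               ∎
      where
      single : ∀ s → s < length (suffixSums (columnEntries k ℓ n)) → fromDepth e s ≡ 1
      single s s<len = begin
        #paths (e , ceiling e ∸ s) (e ∸ e) (s + (m ∸ ceiling e))
          ≡⟨ cong₂ (λ y j → #paths (e , y) (e ∸ e) j) (cong (_∸ s) ceiling-e)
               (trans (cong (λ c → s + (m ∸ c)) ceiling-e) (trans (cong (s +_) (ℕ.n∸n≡0 m)) (ℕ.+-identityʳ s))) ⟩
        #paths (e , m ∸ s) (e ∸ e) s
          ≡⟨ cong (λ i → #paths (e , m ∸ s) i s) (ℕ.n∸n≡0 e) ⟩
        #paths (e , m ∸ s) 0 s
          ≡⟨ #paths-last-column e m (λ y y≤m → ℕ.≤-refl , subst (y ≤_) (sym ceiling-e) y≤m) s s≤m ⟩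
        1 ∎
        where
        s≤m : s ≤ m
        s≤m = subst (s ≤_) (sym m≡blockCeiling)
          (ℕ.≤-pred (subst (s <_) (trans (length-suffixSums (columnEntries k ℓ n)) (length-columnEntries n)) s<len))

    blockSteps finalSteps : List Step
    blockSteps = replicate k N ++ replicate ℓ E
    finalSteps = replicate k N ++ E ∷ []

    -- boundary k ℓ (suc n) is stepsFrom n
    stepsFrom : ℕ → List Step
    stepsFrom t = concat (replicate t blockSteps) ++ finalSteps

    stepsFrom-suc : ∀ t → stepsFrom (suc t) ≡ blockSteps ++ stepsFrom t
    stepsFrom-suc t = ++-assoc blockSteps (concat (replicate t blockSteps)) finalSteps
      where open import Data.List.Properties using (++-assoc)

    blockStart : ℕ → Point
    blockStart i = (i * ℓ , i * k)

    endpoint-blockSteps : ∀ i → endpoint (blockStart i) blockSteps ≡ blockStart (suc i)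
    endpoint-blockSteps i = begin
      endpoint (blockStart i) (replicate k N ++ replicate ℓ E)          ≡⟨ endpoint-++ (blockStart i) (replicate k N) (replicate ℓ E) ⟩
      endpoint (endpoint (blockStart i) (replicate k N)) (replicate ℓ E) ≡⟨ cong (λ p → endpoint p (replicate ℓ E)) (endpoint-Nⁿ k (i * ℓ) (i * k)) ⟩
      endpoint (i * ℓ , k + i * k) (replicate ℓ E)                     ≡⟨ endpoint-Eⁿ ℓ (i * ℓ) (k + i * k) ⟩
      blockStart (suc i)                                               ∎

    ceiling-blockStart : ∀ i → ceiling (i * ℓ) ≡ blockCeiling i
    ceiling-blockStart i = trans (cong ceiling (sym (ℕ.+-identityʳ (i * ℓ)))) (ceiling-block i 0 (s≤s z≤n))

    admissible-from-block : ∀ i {x y} → i * ℓ ≤ x → x ≤ e → y ≤ blockCeiling i → Admissible (x , y)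
    admissible-from-block i {x} iℓ≤x x≤e y≤c = x≤e , ℕ.≤-trans y≤c (subst (_≤ ceiling x) (ceiling-blockStart i) (ceiling-mono iℓ≤x))

    stepsFrom-admissible : ∀ t i → i + t ≡ n → All Admissible (points (blockStart i) (stepsFrom t))
    stepsFrom-admissible zero i i+0≡n = All-points-++ (blockStart i) (replicate k N) (E ∷ [])
      (All-points-Nⁿ k (i * ℓ) (i * k) (λ u u≤k → admissible-from-block i ℕ.≤-refl iℓ≤e (ℕ.+-monoˡ-≤ (i * k) u≤k)))
      (subst (λ p → All Admissible (points p (E ∷ []))) (sym (endpoint-Nⁿ k (i * ℓ) (i * k)))
        (admissible-from-block i ℕ.≤-refl iℓ≤e ℕ.≤-refl ∷ admissible-from-block i (ℕ.n≤1+n _) 1+iℓ≤e ℕ.≤-refl ∷ []))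
      where
      1+iℓ≤e : suc (i * ℓ) ≤ e
      1+iℓ≤e = subst (λ j → suc (j * ℓ) ≤ e) (trans (sym i+0≡n) (ℕ.+-identityʳ i)) (ℕ.≤-reflexive (ℕ.+-comm 1 (n * ℓ)))
      iℓ≤e : i * ℓ ≤ e
      iℓ≤e = ℕ.≤-trans (ℕ.n≤1+n _) 1+iℓ≤e
    stepsFrom-admissible (suc t) i i+1+t≡n = subst (λ s → All Admissible (points (blockStart i) s)) (sym (stepsFrom-suc t))
      (All-points-++ (blockStart i) blockSteps (stepsFrom t)
        (All-points-++ (blockStart i) (replicate k N) (replicate ℓ E)
          (All-points-Nⁿ k (i * ℓ) (i * k) (λ u u≤k → admissible-from-block i ℕ.≤-refl iℓ≤e (ℕ.+-monoˡ-≤ (i * k) u≤k)))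
          (subst (λ p → All Admissible (points p (replicate ℓ E))) (sym (endpoint-Nⁿ k (i * ℓ) (i * k)))
            (All-points-Eⁿ ℓ (i * ℓ) (k + i * k) (λ v v≤ℓ →
              admissible-from-block i (ℕ.m≤n+m (i * ℓ) v) (ℕ.≤-trans (ℕ.+-monoˡ-≤ (i * ℓ) v≤ℓ) ℓ+iℓ≤e) ℕ.≤-refl))))
        (subst (λ p → All Admissible (points p (stepsFrom t))) (sym (endpoint-blockSteps i))
          (stepsFrom-admissible t (suc i) (trans (sym (ℕ.+-suc i t)) i+1+t≡n))))
      where
      ℓ+iℓ≤e : ℓ + i * ℓ ≤ e
      ℓ+iℓ≤e = ℕ.≤-trans (ℕ.*-monoˡ-≤ ℓ (subst (suc i ≤_) i+1+t≡n (ℕ.≤-trans (s≤s (ℕ.m≤m+n i t)) (ℕ.≤-reflexive (sym (ℕ.+-suc i t))))))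
        (ℕ.m≤m+n (n * ℓ) 1)
      iℓ≤e : i * ℓ ≤ e
      iℓ≤e = ℕ.≤-trans (ℕ.m≤n+m (i * ℓ) ℓ) ℓ+iℓ≤e

    module _ {P : Point → Set} where

      Any-stepsFrom⇒boundary : ∀ i t → i + t ≡ n → Any P (points (blockStart i) (stepsFrom t)) → Any P (points (0 , 0) (boundary k ℓ (suc n)))
      Any-stepsFrom⇒boundary zero t t≡n any = subst (λ t′ → Any P (points (0 , 0) (stepsFrom t′))) t≡n any
      Any-stepsFrom⇒boundary (suc i) t i+1+t≡n any = Any-stepsFrom⇒boundary i (suc t) (trans (ℕ.+-suc i t) i+1+t≡n)
        (subst (λ s → Any P (points (blockStart i) s)) (sym (stepsFrom-suc t))
          (Any-points-++ʳ (blockStart i) blockSteps (stepsFrom t) (subst (λ p → Any P (points p (stepsFrom t))) (sym (endpoint-blockSteps i)) any)))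

    ceiling∈blockSteps : ∀ j v → v ≤ ℓ → (v + j * ℓ , blockCeiling j) ∈ points (blockStart j) blockSteps
    ceiling∈blockSteps j v v≤ℓ = Any-points-++ʳ (blockStart j) (replicate k N) (replicate ℓ E)
      (subst (λ p → (v + j * ℓ , blockCeiling j) ∈ points p (replicate ℓ E)) (sym (endpoint-Nⁿ k (j * ℓ) (j * k)))
        (Any-points-Eⁿ ℓ (j * ℓ) (k + j * k) v v≤ℓ refl))

    ceiling∈finalSteps : ∀ v → v ≤ 1 → (v + n * ℓ , blockCeiling n) ∈ points (blockStart n) finalSteps
    ceiling∈finalSteps zero _ = Any-points-++ˡ (blockStart n) (replicate k N) (E ∷ [])
      (Any-points-Nⁿ k (n * ℓ) (n * k) k ℕ.≤-refl refl)
    ceiling∈finalSteps (suc zero) _ = Any-points-++ʳ (blockStart n) (replicate k N) (E ∷ [])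
      (subst (λ p → (1 + n * ℓ , blockCeiling n) ∈ points p (E ∷ [])) (sym (endpoint-Nⁿ k (n * ℓ) (n * k))) (there (here refl)))
    ceiling∈finalSteps (suc (suc _)) (s≤s ())

    ceiling∈boundary′ : ∀ j r → r < ℓ → j ≤ n → r + j * ℓ ≤ e → (r + j * ℓ , blockCeiling j) ∈ points (0 , 0) (boundary k ℓ (suc n))
    ceiling∈boundary′ j r r<ℓ j≤n _ with ℕ.m≤n⇒m<n∨m≡n j≤n
    ... | inj₁ j<n = Any-stepsFrom⇒boundary j (suc (n ∸ suc j)) (trans (ℕ.+-suc j (n ∸ suc j)) (ℕ.m+[n∸m]≡n j<n))
      (Any-points-++ˡ (blockStart j) (blockSteps ++ concat (replicate (n ∸ suc j) blockSteps)) finalSteps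
        (Any-points-++ˡ (blockStart j) blockSteps (concat (replicate (n ∸ suc j) blockSteps)) (ceiling∈blockSteps j r (ℕ.<⇒≤ r<ℓ))))
    ceiling∈boundary′ j r r<ℓ j≤n r+nℓ≤e | inj₂ refl = Any-stepsFrom⇒boundary n 0 (ℕ.+-identityʳ n)
      (ceiling∈finalSteps r (ℕ.+-cancelʳ-≤ (n * ℓ) r 1 (subst (r + n * ℓ ≤_) (ℕ.+-comm (n * ℓ) 1) r+nℓ≤e)))

    ceiling∈boundary : ∀ a → a ≤ e → (a , ceiling a) ∈ points (0 , 0) (boundary k ℓ (suc n))
    ceiling∈boundary a a≤e = subst (λ x → (x , ceiling a) ∈ points (0 , 0) (boundary k ℓ (suc n))) (sym a≡r+jℓ)
      (ceiling∈boundary′ (a / ℓ) (a % ℓ) (m%n<n a ℓ) (ℕ.≤-pred (m<n*o⇒m/o<n a<[1+n]ℓ)) (subst (_≤ e) a≡r+jℓ a≤e))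
      where
      open import Data.Nat.DivMod using (m≡m%n+[m/n]*n; m%n<n; m<n*o⇒m/o<n)
      a≡r+jℓ : a ≡ a % ℓ + a / ℓ * ℓ
      a≡r+jℓ = m≡m%n+[m/n]*n a ℓ
      a<[1+n]ℓ : a < suc n * ℓ
      a<[1+n]ℓ = ℕ.≤-<-trans a≤e (subst (n * ℓ + 1 <_) (ℕ.+-comm (n * ℓ) ℓ) (ℕ.+-monoʳ-< (n * ℓ) 1<ℓ))

    weaklyBelow⇒admissible : ∀ q → WeaklyBelowPt (boundary k ℓ (suc n)) q → Admissible q
    weaklyBelow⇒admissible (a , b) below with find below
    ... | (x , y) , q∈B , (refl , b≤y) with All.lookup (stepsFrom-admissible n 0 refl) q∈B
    ...   | x≤e , y≤c = x≤e , ℕ.≤-trans b≤y y≤c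

    admissible⇒weaklyBelow : ∀ q → Admissible q → WeaklyBelowPt (boundary k ℓ (suc n)) q
    admissible⇒weaklyBelow (a , b) (a≤e , b≤c) = Any.map (λ { refl → refl , b≤c }) (ceiling∈boundary a a≤e)

    f≡#paths : f k ℓ (suc n) ≡ #paths (0 , 0) e m
    f≡#paths = trans (cong (λ x → length (filter (λ P → neverAbove? P (boundary k ℓ (suc n))) (allPaths x m))) width)
      (cong length (filter-≐ (λ P → neverAbove? P (boundary k ℓ (suc n))) (inRegion? (0 , 0))
        (All.map (λ {q} → weaklyBelow⇒admissible q) , All.map (λ {q} → admissible⇒weaklyBelow q)) (allPaths e m)))
      where
      open import Data.List.Properties using (filter-≐)
      width : ℓ * suc n ∸ ℓ + 1 ≡ e
      width = cong (_+ 1) (trans (cong (_∸ ℓ) (ℕ.*-suc ℓ n)) (trans (ℕ.m+n∸m≡n ℓ (ℓ * n)) (ℕ.*-comm ℓ n)))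

    f≡sum-columnEntries : f k ℓ (suc n) ≡ sum (suffixSums (columnEntries k ℓ n))
    f≡sum-columnEntries = trans f≡#paths #paths-origin

open LatticePathCounting using (suffixSums; columnEntries; module BoundaryRegion)

-- The standard library's ring solver needs coefficients with a decidable equality; the integers,
-- mapped into an arbitrary commutative ring, provide them.
module IntegerRingSolver {c ℓ : Level} (R : CommutativeRing c ℓ) where
  open CommutativeRing R
  open import Data.Integer using (ℤ; +_; -[1+_]; _⊖_)
  open import Data.Maybe using (Maybe; just; nothing)
  open import Algebra.Properties.Ring ring using (-‿involutive; -0#≈0#; -‿distribˡ-*; -‿anti-homo-+)
  open import Algebra.Properties.Semiring.Mult semiring using (_×_; ×-homo-+; ×1-homo-*)
  open import Relation.Binary.Reasoning.Setoid setoid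
  import Data.Integer as ℤ
  import Data.Integer.Properties as ℤ
  import Data.Sign as Sign
  import Algebra.Solver.Ring.AlmostCommutativeRing as ACR

  ⟦_⟧ : ℤ → Carrier
  ⟦ + n ⟧ = n × 1#
  ⟦ -[1+ n ] ⟧ = - (suc n × 1#)

  ⟦-⟧ : ∀ i → ⟦ ℤ.- i ⟧ ≈ - ⟦ i ⟧
  ⟦-⟧ (+ zero) = sym -0#≈0#
  ⟦-⟧ (+ suc n) = refl
  ⟦-⟧ -[1+ n ] = sym (-‿involutive _)

  ⟦⊖⟧ : ∀ m n → ⟦ m ⊖ n ⟧ ≈ m × 1# - n × 1#
  ⟦⊖⟧ zero zero = sym (trans (+-congˡ -0#≈0#) (+-identityʳ _))
  ⟦⊖⟧ (suc m) zero = sym (trans (+-congˡ -0#≈0#) (+-identityʳ _))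
  ⟦⊖⟧ zero (suc n) = sym (+-identityˡ _)
  ⟦⊖⟧ (suc m) (suc n) = begin
    ⟦ suc m ⊖ suc n ⟧           ≡⟨ ≡.cong ⟦_⟧ (ℤ.[1+m]⊖[1+n]≡m⊖n m n) ⟩
    ⟦ m ⊖ n ⟧                   ≈⟨ ⟦⊖⟧ m n ⟩
    x - y                       ≈⟨ +-congʳ (sym (trans (+-assoc x 1# (- 1#)) (trans (+-congˡ (-‿inverseʳ 1#)) (+-identityʳ x)))) ⟩
    (x + 1#) + - 1# - y         ≈⟨ +-assoc (x + 1#) (- 1#) (- y) ⟩
    (x + 1#) + (- 1# - y)       ≈⟨ +-cong (+-comm x 1#) (sym (-‿anti-homo-+ y 1#)) ⟩
    (1# + x) - (y + 1#)         ≈⟨ +-congˡ (-‿cong (+-comm y 1#)) ⟩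
    (1# + x) - (1# + y)         ∎
    where x = m × 1#; y = n × 1#

  ⟦+⟧ : ∀ i j → ⟦ i ℤ.+ j ⟧ ≈ ⟦ i ⟧ + ⟦ j ⟧
  ⟦+⟧ (+ m) (+ n) = ×-homo-+ 1# m n
  ⟦+⟧ (+ m) -[1+ n ] = ⟦⊖⟧ m (suc n)
  ⟦+⟧ -[1+ m ] (+ n) = trans (⟦⊖⟧ n (suc m)) (+-comm _ _)
  ⟦+⟧ -[1+ m ] -[1+ n ] = begin
    - (suc (suc (m ℕ.+ n)) × 1#)     ≡⟨ ≡.cong (λ k → - (suc k × 1#)) (≡.sym (ℕ.+-suc m n)) ⟩
    - ((suc m ℕ.+ suc n) × 1#)       ≈⟨ -‿cong (×-homo-+ 1# (suc m) (suc n)) ⟩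
    - (suc m × 1# + suc n × 1#)      ≈⟨ -‿anti-homo-+ (suc m × 1#) (suc n × 1#) ⟩
    - (suc n × 1#) - (suc m × 1#)    ≈⟨ +-comm (- (suc n × 1#)) (- (suc m × 1#)) ⟩
    - (suc m × 1#) - (suc n × 1#)    ∎

  ⟦_⟧ₛ : Sign.Sign → Carrier
  ⟦ Sign.+ ⟧ₛ = 1#
  ⟦ Sign.- ⟧ₛ = - 1#

  ⟦◃⟧ : ∀ s n → ⟦ s ℤ.◃ n ⟧ ≈ ⟦ s ⟧ₛ * (n × 1#)
  ⟦◃⟧ s zero = sym (zeroʳ _)
  ⟦◃⟧ Sign.+ (suc n) = sym (*-identityˡ _)
  ⟦◃⟧ Sign.- (suc n) = trans (-‿cong (sym (*-identityˡ _))) (-‿distribˡ-* _ _)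

  ⟦*⟧ₛ : ∀ s t → ⟦ s Sign.* t ⟧ₛ ≈ ⟦ s ⟧ₛ * ⟦ t ⟧ₛ
  ⟦*⟧ₛ Sign.+ t = sym (*-identityˡ _)
  ⟦*⟧ₛ Sign.- Sign.+ = sym (*-identityʳ _)
  ⟦*⟧ₛ Sign.- Sign.- = sym (trans (sym (-‿distribˡ-* _ _)) (trans (-‿cong (*-identityˡ _)) (-‿involutive _)))

  ⟦⟧-sign-abs : ∀ i → ⟦ i ⟧ ≈ ⟦ ℤ.sign i ⟧ₛ * (ℤ.∣ i ∣ × 1#)
  ⟦⟧-sign-abs (+ n) = sym (*-identityˡ _)
  ⟦⟧-sign-abs -[1+ n ] = trans (-‿cong (sym (*-identityˡ _))) (-‿distribˡ-* _ _)

  ⟦*⟧ : ∀ i j → ⟦ i ℤ.* j ⟧ ≈ ⟦ i ⟧ * ⟦ j ⟧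
  ⟦*⟧ i j = begin
    ⟦ (ℤ.sign i Sign.* ℤ.sign j) ℤ.◃ (ℤ.∣ i ∣ ℕ.* ℤ.∣ j ∣) ⟧ ≈⟨ ⟦◃⟧ (ℤ.sign i Sign.* ℤ.sign j) (ℤ.∣ i ∣ ℕ.* ℤ.∣ j ∣) ⟩
    ⟦ ℤ.sign i Sign.* ℤ.sign j ⟧ₛ * ((ℤ.∣ i ∣ ℕ.* ℤ.∣ j ∣) × 1#) ≈⟨ *-cong (⟦*⟧ₛ (ℤ.sign i) (ℤ.sign j)) (×1-homo-* ℤ.∣ i ∣ ℤ.∣ j ∣) ⟩
    (s * t) * (a * b) ≈⟨ interchange s t a b ⟩
    (s * a) * (t * b) ≈⟨ sym (*-cong (⟦⟧-sign-abs i) (⟦⟧-sign-abs j)) ⟩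
    ⟦ i ⟧ * ⟦ j ⟧ ∎
    where
    open import Algebra.Properties.CommutativeSemigroup *-commutativeSemigroup using (interchange)
    s = ⟦ ℤ.sign i ⟧ₛ
    t = ⟦ ℤ.sign j ⟧ₛ
    a = ℤ.∣ i ∣ × 1#
    b = ℤ.∣ j ∣ × 1#

  ℤ-rawRing : RawRing _ _
  ℤ-rawRing = record
    { Carrier = ℤ ; _≈_ = _≡_ ; _+_ = ℤ._+_ ; _*_ = ℤ._*_ ; -_ = ℤ.-_ ; 0# = + 0 ; 1# = + 1 }

  ⟦⟧-homomorphism : ℤ-rawRing ACR.-Raw-AlmostCommutative⟶ ACR.fromCommutativeRing R
  ⟦⟧-homomorphism = record
    { ⟦_⟧ = ⟦_⟧ ; +-homo = ⟦+⟧ ; *-homo = ⟦*⟧ ; -‿homo = ⟦-⟧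
    ; 0-homo = refl ; 1-homo = +-identityʳ 1# }

  ⟦⟧-weaklyInjective : ∀ i j → Maybe (⟦ i ⟧ ≈ ⟦ j ⟧)
  ⟦⟧-weaklyInjective i j with i ℤ.≟ j
  ... | yes ≡.refl = just refl
  ... | no _ = nothing

  open import Algebra.Solver.Ring ℤ-rawRing (ACR.fromCommutativeRing R) ⟦⟧-homomorphism ⟦⟧-weaklyInjective public
    using (solve; _:=_; _:+_; _:*_; :-_; _:-_; _:^_; con)

module CommutativeRingIdentities {a ℓ : Level} (A : CommutativeRing a ℓ) where
  open CommutativeRing A
  open import Data.Vec using (Vec; []; _∷_; map)
  open import Algebra.Properties.CommutativeSemiring.Exp commutativeSemiring using (_^_; ^-congˡ)
  open import Algebra.Properties.Semiring.Mult semiring using (_×_; ×-homo-+)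
  open import Algebra.Properties.Semiring.Sum semiring using (sum; sum-cong-≋; *-distribˡ-sum)
  module ∏ = Algebra.Properties.Monoid.Sum *-monoid
  open ∏ using () renaming (sum to product)
  open import Relation.Binary.Reasoning.Setoid setoid
  open IntegerRingSolver A using (solve; _:=_; _:+_; _:*_; _:-_; :-_; _:^_; con)
  open import Data.Nat.ListAction using () renaming (sum to sumℕ)
  import Data.Integer as ℤ

  geometricSum : ℕ → Carrier → Carrier → Carrier
  geometricSum zero x y = 0#
  geometricSum (suc n) x y = x ^ n + y * geometricSum n x y

  geometricSum-cong : ∀ n {x x′ y y′} → x ≈ x′ → y ≈ y′ → geometricSum n x y ≈ geometricSum n x′ y′
  geometricSum-cong zero x≈x′ y≈y′ = refl
  geometricSum-cong (suc n) x≈x′ y≈y′ = +-cong (^-congˡ n x≈x′) (*-cong y≈y′ (geometricSum-cong n x≈x′ y≈y′))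

  ^-difference : ∀ n x y → x ^ n - y ^ n ≈ (x - y) * geometricSum n x y
  ^-difference zero x y = trans (-‿inverseʳ 1#) (sym (zeroʳ (x - y)))
  ^-difference (suc n) x y = begin
    x * x ^ n - y * y ^ n
      ≈⟨ +-congˡ (-‿cong (*-congˡ yⁿ≈)) ⟩
    x * x ^ n - y * (x ^ n - (x - y) * geometricSum n x y)
      ≈⟨ solve 4 (λ x y X G → x :* X :- y :* (X :- (x :- y) :* G) := (x :- y) :* (X :+ y :* G)) refl x y (x ^ n) _ ⟩
    (x - y) * geometricSum (suc n) x y ∎
    where
    yⁿ≈ : y ^ n ≈ x ^ n - (x - y) * geometricSum n x y
    yⁿ≈ = begin
      y ^ n                                                  ≈⟨ solve 2 (λ X Y → Y := X :- (X :- Y)) refl (x ^ n) (y ^ n) ⟩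
      x ^ n - (x ^ n - y ^ n)                                ≈⟨ +-congˡ (-‿cong (^-difference n x y)) ⟩
      x ^ n - (x - y) * geometricSum n x y                   ∎

  geometricSum-diagonal : ∀ n x → geometricSum (suc n) x x ≈ (suc n × 1#) * x ^ n
  geometricSum-diagonal zero x = solve 1 (λ x → x :^ 0 :+ x :* con (ℤ.+ 0) := (x :^ 0 :+ con (ℤ.+ 0)) :* x :^ 0) refl x
  geometricSum-diagonal (suc n) x = begin
    x * x ^ n + x * geometricSum (suc n) x x
      ≈⟨ +-congˡ (*-congˡ (geometricSum-diagonal n x)) ⟩
    x * x ^ n + x * ((suc n × 1#) * x ^ n)
      ≈⟨ solve 3 (λ x X N → x :* X :+ x :* (N :* X) := (x :^ 0 :+ N) :* (x :* X)) refl x (x ^ n) (suc n × 1#) ⟩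
    (1# + suc n × 1#) * (x * x ^ n) ∎

  evalℕ : List ℕ → Carrier → Carrier
  evalℕ [] x = 0#
  evalℕ (p ∷ ps) x = p × 1# + x * evalℕ ps x

  evalℕ-suffixSums : ∀ ps x → (x - 1#) * evalℕ (suffixSums ps) x ≈ x * evalℕ ps x - sumℕ ps × 1#
  evalℕ-suffixSums [] x = solve 1 (λ x → (x :- x :^ 0) :* con (ℤ.+ 0) := x :* con (ℤ.+ 0) :- con (ℤ.+ 0)) refl x
  evalℕ-suffixSums (p ∷ ps) x = begin
    (x - 1#) * ((p ℕ.+ sumℕ ps) × 1# + x * evalℕ (suffixSums ps) x)
      ≈⟨ *-congˡ (+-congʳ (×-homo-+ 1# p (sumℕ ps))) ⟩
    (x - 1#) * ((P + S) + x * evalℕ (suffixSums ps) x)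
      ≈⟨ solve 5 (λ x P S E o → (x :- o) :* ((P :+ S) :+ x :* E) := (x :- o) :* (P :+ S) :+ x :* ((x :- o) :* E)) refl x P S _ 1# ⟩
    (x - 1#) * (P + S) + x * ((x - 1#) * evalℕ (suffixSums ps) x)
      ≈⟨ +-congˡ (*-congˡ (evalℕ-suffixSums ps x)) ⟩
    (x - 1#) * (P + S) + x * (x * evalℕ ps x - S)
      ≈⟨ solve 5 (λ x P S E o → (x :- o) :* (P :+ S) :+ x :* (x :* E :- S) := x :* (P :+ x :* E) :- o :* (P :+ S)) refl x P S (evalℕ ps x) 1# ⟩
    x * evalℕ (p ∷ ps) x - 1# * (P + S)
      ≈⟨ +-congˡ (-‿cong (trans (*-identityˡ _) (sym (×-homo-+ 1# p (sumℕ ps))))) ⟩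
    x * evalℕ (p ∷ ps) x - (p ℕ.+ sumℕ ps) × 1# ∎
    where
    P = p × 1#
    S = sumℕ ps × 1#

  evalℕ-pad : ∀ k ps x → evalℕ (replicate k 0 ++ ps) x ≈ x ^ k * evalℕ ps x
  evalℕ-pad zero ps x = sym (*-identityˡ _)
  evalℕ-pad (suc k) ps x = begin
    0# + x * evalℕ (replicate k 0 ++ ps) x ≈⟨ +-congˡ (*-congˡ (evalℕ-pad k ps x)) ⟩
    0# + x * (x ^ k * evalℕ ps x)          ≈⟨ solve 3 (λ x X E → con (ℤ.+ 0) :+ x :* (X :* E) := (x :* X) :* E) refl x (x ^ k) (evalℕ ps x) ⟩
    (x * x ^ k) * evalℕ ps x               ∎

  -- remainder i c x = Σ_{r<i} x^(i-1-r) (x-1)^r c(r)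
  remainder : ℕ → (ℕ → Carrier) → Carrier → Carrier
  remainder zero c x = 0#
  remainder (suc i) c x = x * remainder i c x + (x - 1#) ^ i * c i

  evalℕ-fold-suffixSums : ∀ i q x →
    (x - 1#) ^ i * evalℕ (fold q suffixSums i) x ≈ x ^ i * evalℕ q x - remainder i (λ r → sumℕ (fold q suffixSums r) × 1#) x
  evalℕ-fold-suffixSums zero q x = solve 1 (λ E → E := E :- con (ℤ.+ 0)) refl (1# * evalℕ q x)
  evalℕ-fold-suffixSums (suc i) q x = begin
    ((x - 1#) * Zⁱ) * evalℕ (suffixSums Tⁱq) x
      ≈⟨ solve 3 (λ Z P E → (Z :* P) :* E := P :* (Z :* E)) refl (x - 1#) Zⁱ _ ⟩
    Zⁱ * ((x - 1#) * evalℕ (suffixSums Tⁱq) x)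
      ≈⟨ *-congˡ (evalℕ-suffixSums Tⁱq x) ⟩
    Zⁱ * (x * evalℕ Tⁱq x - C)
      ≈⟨ solve 4 (λ P x E C → P :* (x :* E :- C) := x :* (P :* E) :- P :* C) refl Zⁱ x _ C ⟩
    x * (Zⁱ * evalℕ Tⁱq x) - Zⁱ * C
      ≈⟨ +-congʳ (*-congˡ (evalℕ-fold-suffixSums i q x)) ⟩
    x * (x ^ i * evalℕ q x - Rem) - Zⁱ * C
      ≈⟨ solve 5 (λ x X E Rm D → x :* (X :* E :- Rm) :- D := (x :* X) :* E :- (x :* Rm :+ D)) refl x (x ^ i) (evalℕ q x) Rem (Zⁱ * C) ⟩
    (x * x ^ i) * evalℕ q x - (x * Rem + Zⁱ * C) ∎
    where
    Zⁱ = (x - 1#) ^ i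
    Tⁱq = fold q suffixSums i
    C = sumℕ Tⁱq × 1#
    Rem = remainder i (λ r → sumℕ (fold q suffixSums r) × 1#) x

  remainder-cong : ∀ i {c d} x → (∀ r → c r ≈ d r) → remainder i c x ≈ remainder i d x
  remainder-cong zero x c≈d = refl
  remainder-cong (suc i) x c≈d = +-cong (*-congˡ (remainder-cong i x c≈d)) (*-congˡ (c≈d i))

  remainder-linear : ∀ i c d s x → remainder i (λ r → c r + s * d r) x ≈ remainder i c x + s * remainder i d x
  remainder-linear zero c d s x = solve 1 (λ s → con (ℤ.+ 0) := con (ℤ.+ 0) :+ s :* con (ℤ.+ 0)) refl s
  remainder-linear (suc i) c d s x = begin
    x * remainder i (λ r → c r + s * d r) x + Zⁱ * (c i + s * d i)
      ≈⟨ +-congʳ (*-congˡ (remainder-linear i c d s x)) ⟩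
    x * (Rc + s * Rd) + Zⁱ * (c i + s * d i)
      ≈⟨ solve 7 (λ x Rc Rd s Z c d → x :* (Rc :+ s :* Rd) :+ Z :* (c :+ s :* d) := (x :* Rc :+ Z :* c) :+ s :* (x :* Rd :+ Z :* d)) refl x Rc Rd s Zⁱ (c i) (d i) ⟩
    (x * Rc + Zⁱ * c i) + s * (x * Rd + Zⁱ * d i) ∎
    where
    Zⁱ = (x - 1#) ^ i
    Rc = remainder i c x
    Rd = remainder i d x

  eval : ∀ {n} → Vec Carrier n → Carrier → Carrier
  eval [] z = 0#
  eval (d ∷ ds) z = d + z * eval ds z

  addToHead : ∀ {n} → Carrier → Vec Carrier (suc n) → Vec Carrier (suc n)
  addToHead p (d ∷ ds) = (p + d) ∷ ds

  -- the coefficients of (1 + z) p(z) + b zⁿ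
  timesOnePlus : ∀ {n} → Vec Carrier n → Carrier → Vec Carrier (suc n)
  timesOnePlus [] b = b ∷ []
  timesOnePlus (p ∷ ps) b = p ∷ addToHead p (timesOnePlus ps b)

  eval-addToHead : ∀ {n} p (ds : Vec Carrier (suc n)) z → eval (addToHead p ds) z ≈ p + eval ds z
  eval-addToHead p (d ∷ ds) z = +-assoc p d (z * eval ds z)

  eval-timesOnePlus : ∀ {n} (ps : Vec Carrier n) b z → eval (timesOnePlus ps b) z ≈ (1# + z) * eval ps z + z ^ n * b
  eval-timesOnePlus [] b z = solve 2 (λ b z → b :+ z :* con (ℤ.+ 0) := (z :^ 0 :+ z) :* con (ℤ.+ 0) :+ z :^ 0 :* b) refl b z
  eval-timesOnePlus {suc n} (p ∷ ps) b z = begin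
    p + z * eval (addToHead p (timesOnePlus ps b)) z
      ≈⟨ +-congˡ (*-congˡ (eval-addToHead p (timesOnePlus ps b) z)) ⟩
    p + z * (p + eval (timesOnePlus ps b) z)
      ≈⟨ +-congˡ (*-congˡ (+-congˡ (eval-timesOnePlus ps b z))) ⟩
    p + z * (p + ((1# + z) * eval ps z + z ^ n * b))
      ≈⟨ solve 5 (λ p z E Zn b → p :+ z :* (p :+ ((z :^ 0 :+ z) :* E :+ Zn :* b)) := (z :^ 0 :+ z) :* (p :+ z :* E) :+ (z :* Zn) :* b) refl p z (eval ps z) (z ^ n) b ⟩
    (1# + z) * (p + z * eval ps z) + (z * z ^ n) * b ∎

  remainderCoeffs : (i : ℕ) → (ℕ → Carrier) → Vec Carrier i
  remainderCoeffs zero c = []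
  remainderCoeffs (suc i) c = timesOnePlus (remainderCoeffs i c) (c i)

  remainder≈eval-remainderCoeffs : ∀ i c x → remainder i c x ≈ eval (remainderCoeffs i c) (x - 1#)
  remainder≈eval-remainderCoeffs zero c x = refl
  remainder≈eval-remainderCoeffs (suc i) c x = sym (begin
    eval (timesOnePlus (remainderCoeffs i c) (c i)) (x - 1#)
      ≈⟨ eval-timesOnePlus (remainderCoeffs i c) (c i) (x - 1#) ⟩
    (1# + (x - 1#)) * eval (remainderCoeffs i c) (x - 1#) + (x - 1#) ^ i * c i
      ≈⟨ +-congʳ (*-cong (solve 1 (λ x → x :^ 0 :+ (x :- x :^ 0) := x) refl x)
                                                                                            (sym (remainder≈eval-remainderCoeffs i c x))) ⟩
    x * remainder i c x + (x - 1#) ^ i * c i                                    ∎)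

  head-timesOnePlus : ∀ {n} (ps : Vec Carrier (suc n)) b → Data.Vec.head (timesOnePlus ps b) ≡ Data.Vec.head ps
  head-timesOnePlus (p ∷ ps) b = ≡.refl

  head-remainderCoeffs : ∀ i c → Data.Vec.head (remainderCoeffs (suc i) c) ≡ c 0
  head-remainderCoeffs zero c = ≡.refl
  head-remainderCoeffs (suc i) c = ≡.trans (head-timesOnePlus (remainderCoeffs (suc i) c) (c (suc i))) (head-remainderCoeffs i c)

  second : ∀ {n} → Vec Carrier (suc (suc n)) → Carrier
  second (_ ∷ d ∷ _) = d

  second-remainderCoeffs : ∀ i c → second (remainderCoeffs (suc (suc i)) c) ≈ suc i × c 0 + c 1
  second-remainderCoeffs zero c = +-congʳ (sym (+-identityʳ (c 0)))
  second-remainderCoeffs (suc i) c with remainderCoeffs (suc (suc i)) c | second-remainderCoeffs i c | head-remainderCoeffs (suc i) c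
  ... | d₀ ∷ d₁ ∷ ds | d₁≈ | ≡.refl = trans (+-congˡ d₁≈) (sym (+-assoc (c 0) (suc i × c 0) (c 1)))

  -- the monic polynomial zⁿ + dₙ₋₁ zⁿ⁻¹ + … + d₀ of the coefficients d₀ ∷ … ∷ dₙ₋₁
  evalMonic : ∀ {n} → Vec Carrier n → Carrier → Carrier
  evalMonic [] z = 1#
  evalMonic (d ∷ ds) z = d + z * evalMonic ds z

  evalMonic-negate-scale : ∀ {n} s (ds : Vec Carrier n) z → evalMonic (map (λ d → - (s * d)) ds) z ≈ z ^ n - s * eval ds z
  evalMonic-negate-scale s [] z = solve 2 (λ s z → z :^ 0 := z :^ 0 :- s :* con (ℤ.+ 0)) refl s z
  evalMonic-negate-scale {suc n} s (d ∷ ds) z = begin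
    - (s * d) + z * evalMonic (map (λ d → - (s * d)) ds) z
      ≈⟨ +-congˡ (*-congˡ (evalMonic-negate-scale s ds z)) ⟩
    - (s * d) + z * (z ^ n - s * eval ds z)
      ≈⟨ solve 5 (λ s d z Zn E → :- (s :* d) :+ z :* (Zn :- s :* E) := z :* Zn :- s :* (d :+ z :* E)) refl s d z (z ^ n) (eval ds z) ⟩
    z * z ^ n - s * (d + z * eval ds z) ∎

  coeff₀ coeff₁ : ∀ {n} → Vec Carrier n → Carrier
  coeff₀ [] = 1#
  coeff₀ (d ∷ _) = d
  coeff₁ [] = 0#
  coeff₁ (_ ∷ []) = 1#
  coeff₁ (_ ∷ d ∷ _) = d

  quotient : ∀ {n} → Vec Carrier n → Carrier → Vec Carrier n
  quotient [] c = []
  quotient (p ∷ ps) c = evalMonic (p ∷ ps) c ∷ quotient ps c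

  synthetic-division : ∀ {n} (ps : Vec Carrier n) x c → x * evalMonic ps x - c * evalMonic ps c ≈ (x - c) * evalMonic (quotient ps c) x
  synthetic-division [] x c = solve 2 (λ x c → x :* x :^ 0 :- c :* x :^ 0 := (x :- c) :* x :^ 0) refl x c
  synthetic-division (p ∷ ps) x c = begin
    x * (p + x * Ex) - c * (p + c * Ec)
      ≈⟨ solve 5 (λ x c p Ex Ec → x :* (p :+ x :* Ex) :- c :* (p :+ c :* Ec) := (x :- c) :* (p :+ c :* Ec) :+ x :* (x :* Ex :- c :* Ec)) refl x c p Ex Ec ⟩
    (x - c) * (p + c * Ec) + x * (x * Ex - c * Ec)
      ≈⟨ +-congˡ (*-congˡ (synthetic-division ps x c)) ⟩
    (x - c) * (p + c * Ec) + x * ((x - c) * Q)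
      ≈⟨ solve 4 (λ x c A Q → (x :- c) :* A :+ x :* ((x :- c) :* Q) := (x :- c) :* (A :+ x :* Q)) refl x c (p + c * Ec) Q ⟩
    (x - c) * (p + c * Ec + x * Q) ∎
    where
    Ex = evalMonic ps x
    Ec = evalMonic ps c
    Q = evalMonic (quotient ps c) x

  quotient-root : ∀ {n} p (ps : Vec Carrier n) x c → evalMonic (p ∷ ps) x ≈ 0# → evalMonic (p ∷ ps) c ≈ 0# →
    (x - c) * evalMonic (quotient ps c) x ≈ 0#
  quotient-root p ps x c px≈0 pc≈0 = begin
    (x - c) * evalMonic (quotient ps c) x
      ≈⟨ synthetic-division ps x c ⟨
    x * evalMonic ps x - c * evalMonic ps c
      ≈⟨ solve 3 (λ p A B → A :- B := (p :+ A) :- (p :+ B)) refl p (x * evalMonic ps x) (c * evalMonic ps c) ⟩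
    evalMonic (p ∷ ps) x - evalMonic (p ∷ ps) c
      ≈⟨ +-cong px≈0 (-‿cong pc≈0) ⟩
    0# - 0#
      ≈⟨ -‿inverseʳ 0# ⟩
    0# ∎

  coeff₀-map : ∀ {n} f (ds : Vec Carrier (suc n)) → coeff₀ (map f ds) ≡ f (Data.Vec.head ds)
  coeff₀-map f (d ∷ ds) = ≡.refl

  coeff₁-map : ∀ {n} f (ds : Vec Carrier (suc (suc n))) → coeff₁ (map f ds) ≡ f (second ds)
  coeff₁-map f (d ∷ d′ ∷ ds) = ≡.refl

  coeff₀-quotient : ∀ {n} (ps : Vec Carrier n) c → coeff₀ (quotient ps c) ≡ evalMonic ps c
  coeff₀-quotient [] c = ≡.refl
  coeff₀-quotient (p ∷ ps) c = ≡.refl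

  coeff₁-quotient : ∀ {n} p (ps : Vec Carrier n) c → coeff₁ (p ∷ ps) ≈ coeff₀ (quotient ps c) - c * coeff₁ (quotient ps c)
  coeff₁-quotient p [] c = solve 1 (λ c → c :^ 0 := c :^ 0 :- c :* con (ℤ.+ 0)) refl c
  coeff₁-quotient p (p′ ∷ []) c = solve 2 (λ p′ c → p′ := (p′ :+ c :* c :^ 0) :- c :* c :^ 0) refl p′ c
  coeff₁-quotient p (p′ ∷ p″ ∷ ps) c = solve 3 (λ p′ c E → p′ := (p′ :+ c :* E) :- c :* E) refl p′ c (evalMonic (p″ ∷ ps) c)

  except : ∀ {n} → (Fin n → Carrier) → Fin n → Fin n → Carrier
  except f i j with i ≟ j
  ... | yes _ = 1#
  ... | no _ = f j

  except-suc : ∀ {n} (f : Fin (suc n) → Carrier) i j → except f (fsuc i) (fsuc j) ≈ except (λ j → f (fsuc j)) i j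
  except-suc f i j with i ≟ j
  ... | yes _ = refl
  ... | no _ = refl

  ∑∏-except : ∀ {n} → (Fin n → Carrier) → Carrier
  ∑∏-except f = sum (λ i → product (except f i))

  ∑∏-except-cong : ∀ {n} {f g : Fin n → Carrier} → (∀ j → f j ≈ g j) → ∑∏-except f ≈ ∑∏-except g
  ∑∏-except-cong {f = f} {g} f≈g = sum-cong-≋ (λ i → ∏.sum-cong-≋ (except-cong i))
    where
    except-cong : ∀ i j → except f i j ≈ except g i j
    except-cong i j with i ≟ j
    ... | yes _ = refl
    ... | no _ = f≈g j

  ∑∏-except-suc : ∀ {n} (f : Fin (suc n) → Carrier) → ∑∏-except f ≈ product (λ j → f (fsuc j)) + f fzero * ∑∏-except (λ j → f (fsuc j))
  ∑∏-except-suc f = +-cong (*-identityˡ _) (begin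
    sum (λ i → f fzero * product (λ j → except f (fsuc i) (fsuc j))) ≈⟨ sum-cong-≋ (λ i → *-congˡ (∏.sum-cong-≋ (except-suc f i))) ⟩
    sum (λ i → f fzero * product (except f′ i))                      ≈⟨ *-distribˡ-sum (f fzero) (λ i → product (except f′ i)) ⟨
    f fzero * ∑∏-except f′                                           ∎)
    where f′ = λ j → f (fsuc j)

  CancellativeDifferences : ∀ {n} → (Fin n → Carrier) → Set _
  CancellativeDifferences z = ∀ r s → ¬ r ≡ s → ∀ q → (z r - z s) * q ≈ 0# → q ≈ 0#

  module _ {n} (p : Carrier) (ps : Vec Carrier n) (z : Fin (suc n) → Carrier)
           (roots : ∀ r → evalMonic (p ∷ ps) (z r) ≈ 0#) (cancel : CancellativeDifferences z) where

    quotient-roots : ∀ r → evalMonic (quotient ps (z fzero)) (z (fsuc r)) ≈ 0#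
    quotient-roots r = cancel (fsuc r) fzero (λ ()) _ (quotient-root p ps (z (fsuc r)) (z fzero) (roots (fsuc r)) (roots fzero))

    quotient-cancel : CancellativeDifferences (λ j → z (fsuc j))
    quotient-cancel r s r≢s = cancel (fsuc r) (fsuc s) (λ { ≡.refl → r≢s ≡.refl })

  vieta₀ : ∀ {n} (ds : Vec Carrier n) z → (∀ r → evalMonic ds (z r) ≈ 0#) → CancellativeDifferences z →
    coeff₀ ds ≈ product (λ j → - z j)
  vieta₀ [] z roots cancel = refl
  vieta₀ (p ∷ ps) z roots cancel = begin
    p
      ≈⟨ solve 3 (λ p c E → p := (p :+ c :* E) :+ (:- c) :* E) refl p z₀ (evalMonic ps z₀) ⟩
    evalMonic (p ∷ ps) z₀ + - z₀ * evalMonic ps z₀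
      ≡⟨ ≡.cong (λ e → evalMonic (p ∷ ps) z₀ + - z₀ * e) (coeff₀-quotient ps z₀) ⟨
    evalMonic (p ∷ ps) z₀ + - z₀ * coeff₀ Q
      ≈⟨ +-cong (roots fzero) (*-congˡ (vieta₀ Q _ (quotient-roots p ps z roots cancel) (quotient-cancel p ps z roots cancel))) ⟩
    0# + - z₀ * product (λ j → - z (fsuc j))
      ≈⟨ +-identityˡ _ ⟩
    product (λ j → - z j) ∎
    where
    z₀ = z fzero
    Q = quotient ps z₀

  vieta₁ : ∀ {n} (ds : Vec Carrier n) z → (∀ r → evalMonic ds (z r) ≈ 0#) → CancellativeDifferences z →
    coeff₁ ds ≈ ∑∏-except (λ j → - z j)
  vieta₁ [] z roots cancel = refl
  vieta₁ (p ∷ ps) z roots cancel = begin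
    coeff₁ (p ∷ ps)                             ≈⟨ coeff₁-quotient p ps (z fzero) ⟩
    coeff₀ Q - z fzero * coeff₁ Q               ≈⟨ solve 3 (λ a c b → a :- c :* b := a :+ (:- c) :* b) refl (coeff₀ Q) (z fzero) (coeff₁ Q) ⟩
    coeff₀ Q + - z fzero * coeff₁ Q             ≈⟨ +-cong (vieta₀ Q _ Qroots Qcancel) (*-congˡ (vieta₁ Q _ Qroots Qcancel)) ⟩
    product (λ j → - z (fsuc j)) + - z fzero * ∑∏-except (λ j → - z (fsuc j)) ≈⟨ ∑∏-except-suc (λ j → - z j) ⟨
    ∑∏-except (λ j → - z j)                     ∎
    where
    Q = quotient ps (z fzero)
    Qroots = quotient-roots p ps z roots cancel
    Qcancel = quotient-cancel p ps z roots cancel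

module PowerSeriesRing {c ℓr : Level} (R : CommutativeRing c ℓr) where
  open CommutativeRing R
  open import Algebra.Properties.Semiring.Sum semiring using (sum; sum-cong-≋; sum-replicate-zero; ∑-distrib-+; *-distribˡ-sum)
  open import Relation.Binary.Reasoning.Setoid setoid
  open IntegerRingSolver R using (solve; _:=_; _:+_)

  infix 4 _≋_
  infixl 6 _+ₚ_
  infixl 7 _*ₚ_

  _≋_ : PS R → PS R → Set ℓr
  _≋_ = _≈ₛ_ R

  _+ₚ_ _*ₚ_ : PS R → PS R → PS R
  _+ₚ_ = _+ₛ_ R
  _*ₚ_ = _*ₛ_ R

  -ₚ_ : PS R → PS R
  -ₚ_ = -ₛ_ R

  κ : Carrier → PS R
  κ = constₛ R

  sumFin≡sum : ∀ n (g : Fin n → Carrier) → sumFin R n g ≡ sum g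
  sumFin≡sum zero g = ≡.refl
  sumFin≡sum (suc n) g = ≡.cong (g fzero +_) (sumFin≡sum n (λ i → g (fsuc i)))

  sumFin-cong : ∀ n (g h : Fin n → Carrier) → (∀ i → g i ≈ h i) → sumFin R n g ≈ sumFin R n h
  sumFin-cong n g h g≈h = begin
    sumFin R n g ≡⟨ sumFin≡sum n g ⟩
    sum g        ≈⟨ sum-cong-≋ g≈h ⟩
    sum h        ≡⟨ sumFin≡sum n h ⟨
    sumFin R n h ∎

  sumFin-zero : ∀ n (g : Fin n → Carrier) → (∀ i → g i ≈ 0#) → sumFin R n g ≈ 0#
  sumFin-zero n g g≈0 = begin
    sumFin R n g ≈⟨ sumFin-cong n g (λ _ → 0#) g≈0 ⟩
    sumFin R n (λ _ → 0#) ≡⟨ sumFin≡sum n _ ⟩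
    sum {n} (λ _ → 0#) ≈⟨ sum-replicate-zero n ⟩
    0# ∎

  sumFin-+ : ∀ n (g h : Fin n → Carrier) → sumFin R n (λ i → g i + h i) ≈ sumFin R n g + sumFin R n h
  sumFin-+ n g h = begin
    sumFin R n (λ i → g i + h i) ≡⟨ sumFin≡sum n _ ⟩
    sum (λ i → g i + h i) ≈⟨ ∑-distrib-+ g h ⟩
    sum g + sum h ≡⟨ ≡.cong₂ _+_ (sumFin≡sum n g) (sumFin≡sum n h) ⟨
    sumFin R n g + sumFin R n h ∎

  *-distribˡ-sumFin : ∀ n r (g : Fin n → Carrier) → r * sumFin R n g ≈ sumFin R n (λ i → r * g i)
  *-distribˡ-sumFin n r g = begin
    r * sumFin R n g ≡⟨ ≡.cong (r *_) (sumFin≡sum n g) ⟩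
    r * sum g ≈⟨ *-distribˡ-sum r g ⟩
    sum (λ i → r * g i) ≡⟨ sumFin≡sum n _ ⟨
    sumFin R n (λ i → r * g i) ∎

  ≋-refl : ∀ {a} → a ≋ a
  ≋-refl n = refl

  ≋-sym : ∀ {a b} → a ≋ b → b ≋ a
  ≋-sym a≋b n = sym (a≋b n)

  ≋-trans : ∀ {a b d} → a ≋ b → b ≋ d → a ≋ d
  ≋-trans a≋b b≋d n = trans (a≋b n) (b≋d n)

  -- the coefficient of tⁿ⁺¹ in a *ₚ b is, definitionally, a₀ bₙ₊₁ + (tailₚ a *ₚ b)ₙ
  tailₚ : PS R → PS R
  tailₚ a n = a (suc n)

  shift : PS R → PS R
  shift a zero = 0#
  shift a (suc n) = a n

  +ₚ-cong : ∀ {a a′ b b′} → a ≋ a′ → b ≋ b′ → a +ₚ b ≋ a′ +ₚ b′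
  +ₚ-cong a≋a′ b≋b′ n = +-cong (a≋a′ n) (b≋b′ n)

  -ₚ-cong : ∀ {a a′} → a ≋ a′ → -ₚ a ≋ -ₚ a′
  -ₚ-cong a≋a′ n = -‿cong (a≋a′ n)

  *ₚ-cong : ∀ {a a′ b b′} → a ≋ a′ → b ≋ b′ → a *ₚ b ≋ a′ *ₚ b′
  *ₚ-cong {a} {a′} {b} {b′} a≋a′ b≋b′ n = sumFin-cong (suc n) (λ i → a (toℕ i) * b (n ℕ.∸ toℕ i)) (λ i → a′ (toℕ i) * b′ (n ℕ.∸ toℕ i))
    (λ i → *-cong (a≋a′ (toℕ i)) (b≋b′ (n ℕ.∸ toℕ i)))

  *ₚ-coeff₀ : ∀ a b → (a *ₚ b) 0 ≈ a 0 * b 0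
  *ₚ-coeff₀ a b = +-identityʳ _

  *ₚ-vanishˡ : ∀ a b → (∀ n → a n ≈ 0#) → ∀ n → (a *ₚ b) n ≈ 0#
  *ₚ-vanishˡ a b a≈0 n = sumFin-zero (suc n) (λ i → a (toℕ i) * b (n ℕ.∸ toℕ i)) (λ i → trans (*-congʳ (a≈0 (toℕ i))) (zeroˡ _))

  κ-*ₚ : ∀ r b n → (κ r *ₚ b) n ≈ r * b n
  κ-*ₚ r b zero = *ₚ-coeff₀ (κ r) b
  κ-*ₚ r b (suc n) = trans (+-congˡ (*ₚ-vanishˡ (tailₚ (κ r)) b (λ _ → refl) n)) (+-identityʳ _)

  shift-*ₚ : ∀ a b → shift a *ₚ b ≋ shift (a *ₚ b)
  shift-*ₚ a b zero = trans (*ₚ-coeff₀ (shift a) b) (zeroˡ _)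
  shift-*ₚ a b (suc n) = trans (+-congʳ (zeroˡ _)) (+-identityˡ _)

  split-head : ∀ a → a ≋ κ (a 0) +ₚ shift (tailₚ a)
  split-head a zero = sym (+-identityʳ _)
  split-head a (suc n) = sym (+-identityˡ _)

  *ₚ-distribʳ : ∀ a a′ b → (a +ₚ a′) *ₚ b ≋ a *ₚ b +ₚ a′ *ₚ b
  *ₚ-distribʳ a a′ b n = trans (sumFin-cong (suc n) _ _ (λ i → distribʳ (b (n ℕ.∸ toℕ i)) (a (toℕ i)) (a′ (toℕ i))))
    (sumFin-+ (suc n) (λ i → a (toℕ i) * b (n ℕ.∸ toℕ i)) (λ i → a′ (toℕ i) * b (n ℕ.∸ toℕ i)))

  *ₚ-comm : ∀ a b → a *ₚ b ≋ b *ₚ a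
  *ₚ-comm a b zero = trans (*ₚ-coeff₀ a b) (trans (*-comm _ _) (sym (*ₚ-coeff₀ b a)))
  *ₚ-comm a b (suc zero) = begin
    a 0 * b 1 + (tailₚ a *ₚ b) 0 ≈⟨ +-congˡ (trans (*ₚ-comm (tailₚ a) b 0) (*ₚ-coeff₀ b (tailₚ a))) ⟩
    a 0 * b 1 + b 0 * a 1        ≈⟨ +-comm _ _ ⟩
    b 0 * a 1 + a 0 * b 1        ≈⟨ +-congˡ (sym (trans (*ₚ-comm (tailₚ b) a 0) (*ₚ-coeff₀ a (tailₚ b)))) ⟩
    b 0 * a 1 + (tailₚ b *ₚ a) 0 ∎
  *ₚ-comm a b (suc (suc n)) = begin
    a 0 * b (2 ℕ.+ n) + (tailₚ a *ₚ b) (suc n)                            ≈⟨ +-congˡ (*ₚ-comm (tailₚ a) b (suc n)) ⟩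
    a 0 * b (2 ℕ.+ n) + (b 0 * a (2 ℕ.+ n) + (tailₚ b *ₚ tailₚ a) n)     ≈⟨ +-congˡ (+-congˡ (*ₚ-comm (tailₚ b) (tailₚ a) n)) ⟩
    a 0 * b (2 ℕ.+ n) + (b 0 * a (2 ℕ.+ n) + (tailₚ a *ₚ tailₚ b) n)     ≈⟨ solve 3 (λ x y z → x :+ (y :+ z) := y :+ (x :+ z)) refl _ _ _ ⟩
    b 0 * a (2 ℕ.+ n) + (a 0 * b (2 ℕ.+ n) + (tailₚ a *ₚ tailₚ b) n)     ≈⟨ +-congˡ (*ₚ-comm a (tailₚ b) (suc n)) ⟩
    b 0 * a (2 ℕ.+ n) + (tailₚ b *ₚ a) (suc n)                            ∎

  *ₚ-distribˡ : ∀ a b b′ → a *ₚ (b +ₚ b′) ≋ a *ₚ b +ₚ a *ₚ b′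
  *ₚ-distribˡ a b b′ = ≋-trans (*ₚ-comm a (b +ₚ b′)) (≋-trans (*ₚ-distribʳ b b′ a) (+ₚ-cong (*ₚ-comm b a) (*ₚ-comm b′ a)))

  *ₚ-split-head : ∀ a b → a *ₚ b ≋ κ (a 0) *ₚ b +ₚ shift (tailₚ a *ₚ b)
  *ₚ-split-head a b = ≋-trans (*ₚ-cong (split-head a) (≋-refl {b}))
    (≋-trans (*ₚ-distribʳ (κ (a 0)) (shift (tailₚ a)) b) (+ₚ-cong ≋-refl (shift-*ₚ (tailₚ a) b)))

  κ-*ₚ-assoc : ∀ r b d → (κ r *ₚ b) *ₚ d ≋ κ r *ₚ (b *ₚ d)
  κ-*ₚ-assoc r b d n = begin
    ((κ r *ₚ b) *ₚ d) n
      ≈⟨ sumFin-cong (suc n) _ _ (λ i → trans (*-congʳ (κ-*ₚ r b (toℕ i))) (*-assoc r (b (toℕ i)) (d (n ℕ.∸ toℕ i)))) ⟩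
    sumFin R (suc n) (λ i → r * (b (toℕ i) * d (n ℕ.∸ toℕ i)))
      ≈⟨ *-distribˡ-sumFin (suc n) r (λ i → b (toℕ i) * d (n ℕ.∸ toℕ i)) ⟨
    r * (b *ₚ d) n
      ≈⟨ κ-*ₚ r (b *ₚ d) n ⟨
    (κ r *ₚ (b *ₚ d)) n ∎

  *ₚ-assoc : ∀ a b d → (a *ₚ b) *ₚ d ≋ a *ₚ (b *ₚ d)
  *ₚ-assoc a b d n = begin
    ((a *ₚ b) *ₚ d) n
      ≈⟨ *ₚ-cong (*ₚ-split-head a b) (≋-refl {d}) n ⟩
    ((κ (a 0) *ₚ b +ₚ shift (tailₚ a *ₚ b)) *ₚ d) n
      ≈⟨ *ₚ-distribʳ (κ (a 0) *ₚ b) (shift (tailₚ a *ₚ b)) d n ⟩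
    ((κ (a 0) *ₚ b) *ₚ d) n + (shift (tailₚ a *ₚ b) *ₚ d) n
      ≈⟨ +-cong (κ-*ₚ-assoc (a 0) b d n) (trans (shift-*ₚ (tailₚ a *ₚ b) d n) (shifted n)) ⟩
    (κ (a 0) *ₚ (b *ₚ d)) n + shift (tailₚ a *ₚ (b *ₚ d)) n
      ≈⟨ *ₚ-split-head a (b *ₚ d) n ⟨
    (a *ₚ (b *ₚ d)) n ∎
    where
    shifted : shift ((tailₚ a *ₚ b) *ₚ d) ≋ shift (tailₚ a *ₚ (b *ₚ d))
    shifted zero = refl
    shifted (suc m) = *ₚ-assoc (tailₚ a) b d m

  *ₚ-identityˡ : ∀ a → κ 1# *ₚ a ≋ a
  *ₚ-identityˡ a n = trans (κ-*ₚ 1# a n) (*-identityˡ _)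

  seriesIsCommutativeRing : IsCommutativeRing _≋_ _+ₚ_ _*ₚ_ -ₚ_ (κ 0#) (κ 1#)
  seriesIsCommutativeRing = record
    { isRing = record
      { +-isAbelianGroup = record
        { isGroup = record
          { isMonoid = record
            { isSemigroup = record
              { isMagma = record
                { isEquivalence = record { refl = ≋-refl ; sym = ≋-sym ; trans = ≋-trans }
                ; ∙-cong = +ₚ-cong }
              ; assoc = λ a b d n → +-assoc _ _ _ }
            ; identity = (λ a → λ { zero → +-identityˡ _ ; (suc n) → +-identityˡ _ })
                       , (λ a → λ { zero → +-identityʳ _ ; (suc n) → +-identityʳ _ }) }
          ; inverse = (λ a → λ { zero → -‿inverseˡ _ ; (suc n) → -‿inverseˡ _ })
                    , (λ a → λ { zero → -‿inverseʳ _ ; (suc n) → -‿inverseʳ _ })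
          ; ⁻¹-cong = -ₚ-cong }
        ; comm = λ a b n → +-comm _ _ }
      ; *-cong = *ₚ-cong
      ; *-assoc = *ₚ-assoc
      ; *-identity = *ₚ-identityˡ , (λ a → ≋-trans (*ₚ-comm a (κ 1#)) (*ₚ-identityˡ a))
      ; distrib = *ₚ-distribˡ , (λ a b b′ → *ₚ-distribʳ b b′ a) }
    ; *-comm = *ₚ-comm }

  seriesRing : CommutativeRing c ℓr
  seriesRing = record { isCommutativeRing = seriesIsCommutativeRing }

module PowerSeries {c ℓr : Level} (R : CommutativeRing c ℓr) where
  open CommutativeRing R
  open PowerSeriesRing R public
  module ≈-Reasoning = Relation.Binary.Reasoning.Setoid setoid
  open import Algebra.Properties.Ring ring using (-0#≈0#)
  open import Algebra.Properties.Semiring.Mult semiring using (_×_; ×-homo-+)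
  open import Algebra.Properties.Semiring.Exp semiring using (_^_)

  module 𝕊 = CommutativeRing seriesRing
  open CommutativeRingIdentities seriesRing public using (geometricSum; ^-difference)
  open CommutativeRingIdentities R using () renaming (geometricSum to geometricSumᴿ)
  module ≋-Reasoning = Relation.Binary.Reasoning.Setoid 𝕊.setoid
  open import Algebra.Properties.CommutativeSemiring.Exp 𝕊.commutativeSemiring public
    using () renaming (_^_ to _^ₚ_; ^-congˡ to ^ₚ-congˡ; ^-homo-* to ^ₚ-homo-*ₚ; ^-distrib-* to ^ₚ-distrib-*ₚ)

  open import Algebra.Properties.Semiring.Mult 𝕊.semiring public using () renaming (_×_ to _×ₚ_)

  infixl 6 _-ₚ_

  _-ₚ_ : PS R → PS R → PS R
  _-ₚ_ = 𝕊._-_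

  𝟎 𝟏 : PS R
  𝟎 = κ 0#
  𝟏 = κ 1#

  𝟎-coeff : ∀ n → 𝟎 n ≈ 0#
  𝟎-coeff zero = refl
  𝟎-coeff (suc n) = refl

  κ-cong : ∀ {r s} → r ≈ s → κ r ≋ κ s
  κ-cong r≈s zero = r≈s
  κ-cong r≈s (suc n) = refl

  κ-coeff>0 : ∀ r i → 0 ℕ.< i → κ r i ≈ 0#
  κ-coeff>0 r (suc i) _ = refl

  κ-+ : ∀ r s → κ (r + s) ≋ κ r +ₚ κ s
  κ-+ r s zero = refl
  κ-+ r s (suc n) = sym (+-identityˡ 0#)

  natR≡× : ∀ n → natR R n ≡ n × 1#
  natR≡× zero = ≡.refl
  natR≡× (suc n) = ≡.cong (1# +_) (natR≡× n)

  powₛ≡^ₚ : ∀ a n → powₛ R a n ≡ a ^ₚ n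
  powₛ≡^ₚ a zero = ≡.refl
  powₛ≡^ₚ a (suc n) = ≡.cong (a *ₚ_) (powₛ≡^ₚ a n)

  ^ₚ-coeff₀ : ∀ a n → (a ^ₚ n) 0 ≈ a 0 ^ n
  ^ₚ-coeff₀ a zero = refl
  ^ₚ-coeff₀ a (suc n) = trans (*ₚ-coeff₀ a (a ^ₚ n)) (*-congˡ (^ₚ-coeff₀ a n))

  *ₚ-coeff-order : ∀ a b j → (∀ i → i ℕ.< j → a i ≈ 0#) → (a *ₚ b) j ≈ a j * b 0
  *ₚ-coeff-order a b zero _ = *ₚ-coeff₀ a b
  *ₚ-coeff-order a b (suc j) a<j≈0 = begin
    a 0 * b (suc j) + (tailₚ a *ₚ b) j ≈⟨ +-cong (trans (*-congʳ (a<j≈0 0 (s≤s z≤n))) (zeroˡ _))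
                                                  (*ₚ-coeff-order (tailₚ a) b j (λ i i<j → a<j≈0 (suc i) (s≤s i<j))) ⟩
    0# + a (suc j) * b 0               ≈⟨ +-identityˡ _ ⟩
    a (suc j) * b 0                    ∎
    where open ≈-Reasoning

  ι : ℕ → PS R
  ι n = κ (n × 1#)

  ι≋× : ∀ n → ι n ≋ n ×ₚ 𝟏
  ι≋× zero = ≋-refl
  ι≋× (suc n) = ≋-trans (κ-+ 1# (n × 1#)) (+ₚ-cong ≋-refl (ι≋× n))

  ×ₚ≋ι*ₚ : ∀ n b → n ×ₚ b ≋ ι n *ₚ b
  ×ₚ≋ι*ₚ zero b = ≋-sym (𝕊.zeroˡ b)
  ×ₚ≋ι*ₚ (suc n) b = ≋-trans (+ₚ-cong (≋-sym (*ₚ-identityˡ b)) (×ₚ≋ι*ₚ n b))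
    (≋-trans (≋-sym (*ₚ-distribʳ 𝟏 (ι n) b)) (*ₚ-cong (≋-sym (κ-+ 1# (n × 1#))) (≋-refl {b})))

  κnatR≋ι : ∀ n → κ (natR R n) ≋ ι n
  κnatR≋ι n = κ-cong (reflexive (natR≡× n))

  shiftBy : ℕ → PS R → PS R
  shiftBy zero a = a
  shiftBy (suc m) a = shift (shiftBy m a)

  shiftBy-cong : ∀ m {a b} → a ≋ b → shiftBy m a ≋ shiftBy m b
  shiftBy-cong zero a≋b = a≋b
  shiftBy-cong (suc m) a≋b zero = refl
  shiftBy-cong (suc m) a≋b (suc n) = shiftBy-cong m a≋b n

  shiftBy-below : ∀ m a n → n ℕ.< m → shiftBy m a n ≈ 0#
  shiftBy-below (suc m) a zero _ = refl
  shiftBy-below (suc m) a (suc n) (s≤s n<m) = shiftBy-below m a n n<m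

  shiftBy-above : ∀ m a n → shiftBy m a (m ℕ.+ n) ≡ a n
  shiftBy-above zero a n = ≡.refl
  shiftBy-above (suc m) a n = shiftBy-above m a n

  shiftBy-injective : ∀ m {a b} → shiftBy m a ≋ shiftBy m b → a ≋ b
  shiftBy-injective m {a} {b} eq n = begin
    a n                  ≡⟨ shiftBy-above m a n ⟨
    shiftBy m a (m ℕ.+ n) ≈⟨ eq (m ℕ.+ n) ⟩
    shiftBy m b (m ℕ.+ n) ≡⟨ shiftBy-above m b n ⟩
    b n                  ∎
    where open ≈-Reasoning

  shiftBy-*ₚ : ∀ m a b → shiftBy m a *ₚ b ≋ shiftBy m (a *ₚ b)
  shiftBy-*ₚ zero a b = ≋-refl
  shiftBy-*ₚ (suc m) a b = ≋-trans (shift-*ₚ (shiftBy m a) b) (shiftBy-cong 1 (shiftBy-*ₚ m a b))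

  shiftBy-+ : ∀ m m′ a → shiftBy m (shiftBy m′ a) ≡ shiftBy (m ℕ.+ m′) a
  shiftBy-+ zero m′ a = ≡.refl
  shiftBy-+ (suc m) m′ a = ≡.cong shift (shiftBy-+ m m′ a)

  mono≋shiftBy : ∀ m → monoₛ R m ≋ shiftBy m 𝟏
  mono≋shiftBy m n with m ℕ.≟ n | ℕ.<-cmp n m
  ... | yes ≡.refl | _ = sym (≡.subst (λ i → shiftBy m 𝟏 i ≈ 1#) (ℕ.+-identityʳ m) (reflexive (shiftBy-above m 𝟏 0)))
  ... | no _ | tri< n<m _ _ = sym (shiftBy-below m 𝟏 n n<m)
  ... | no m≢n | tri≈ _ n≡m _ = contradiction (≡.sym n≡m) m≢n
  ... | no _ | tri> _ _ m<n = sym (≡.subst (λ i → shiftBy m 𝟏 i ≈ 0#) (ℕ.m+[n∸m]≡n (ℕ.<⇒≤ m<n))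
                                 (trans (reflexive (shiftBy-above m 𝟏 (n ℕ.∸ m))) (κ-coeff>0 1# (n ℕ.∸ m) (ℕ.m<n⇒0<n∸m m<n))))

  mono-*ₚ : ∀ m a → monoₛ R m *ₚ a ≋ shiftBy m a
  mono-*ₚ m a = ≋-trans (*ₚ-cong (mono≋shiftBy m) (≋-refl {a})) (≋-trans (shiftBy-*ₚ m 𝟏 a) (shiftBy-cong m (*ₚ-identityˡ a)))

  mono-cancel : ∀ m {a b} → monoₛ R m *ₚ a ≋ monoₛ R m *ₚ b → a ≋ b
  mono-cancel m {a} {b} eq = shiftBy-injective m (≋-trans (≋-sym (mono-*ₚ m a)) (≋-trans eq (mono-*ₚ m b)))

  mono-*ₚ-below : ∀ m a n → n ℕ.< m → (monoₛ R m *ₚ a) n ≈ 0#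
  mono-*ₚ-below m a n n<m = trans (mono-*ₚ m a n) (shiftBy-below m a n n<m)

  mono-+ : ∀ m m′ → monoₛ R m *ₚ monoₛ R m′ ≋ monoₛ R (m ℕ.+ m′)
  mono-+ m m′ = ≋-trans (mono-*ₚ m (monoₛ R m′)) (≋-trans (shiftBy-cong m (mono≋shiftBy m′))
    (≋-trans (λ n → reflexive (≡.cong (λ s → s n) (shiftBy-+ m m′ 𝟏))) (≋-sym (mono≋shiftBy (m ℕ.+ m′)))))

  mono-^ : ∀ m n → monoₛ R m ^ₚ n ≋ monoₛ R (m ℕ.* n)
  mono-^ m zero = ≋-trans (≋-sym (mono≋shiftBy 0)) (λ i → reflexive (≡.cong (λ s → monoₛ R s i) (≡.sym (ℕ.*-zeroʳ m))))
  mono-^ m (suc n) = ≋-trans (*ₚ-cong (≋-refl {monoₛ R m}) (mono-^ m n))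
    (≋-trans (mono-+ m (m ℕ.* n)) (λ i → reflexive (≡.cong (λ s → monoₛ R s i) (≡.sym (ℕ.*-suc m n)))))

  drop : ℕ → PS R → PS R
  drop m a n = a (m ℕ.+ n)

  factor-order : ∀ m a → (∀ i → i ℕ.< m → a i ≈ 0#) → a ≋ monoₛ R m *ₚ drop m a
  factor-order m a a<m≈0 = ≋-trans split (≋-sym (mono-*ₚ m (drop m a)))
    where
    split : a ≋ shiftBy m (drop m a)
    split n with ℕ.<-cmp n m
    ... | tri< n<m _ _ = trans (a<m≈0 n n<m) (sym (shiftBy-below m (drop m a) n n<m))
    ... | tri≈ _ ≡.refl _ = ≡.subst (λ i → a i ≈ shiftBy m (drop m a) i) (ℕ.+-identityʳ m) (reflexive (≡.sym (shiftBy-above m (drop m a) 0)))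
    ... | tri> _ _ m<n = ≡.subst (λ i → a i ≈ shiftBy m (drop m a) i) (ℕ.m+[n∸m]≡n (ℕ.<⇒≤ m<n)) (reflexive (≡.sym (shiftBy-above m (drop m a) (n ℕ.∸ m))))

  θ : PS R → PS R
  θ a n = (n × 1#) * a n

  θ-cong : ∀ {a b} → a ≋ b → θ a ≋ θ b
  θ-cong a≋b n = *-congˡ (a≋b n)

  θ-κ : ∀ r → θ (κ r) ≋ 𝟎
  θ-κ r zero = zeroˡ r
  θ-κ r (suc n) = zeroʳ _

  θ-*ₚ : ∀ a b → θ (a *ₚ b) ≋ θ a *ₚ b +ₚ a *ₚ θ b
  θ-*ₚ a b n = begin
    (n × 1#) * (a *ₚ b) n
      ≈⟨ *-distribˡ-sumFin (suc n) (n × 1#) (λ i → a (toℕ i) * b (n ℕ.∸ toℕ i)) ⟩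
    sumFin R (suc n) (λ i → (n × 1#) * (a (toℕ i) * b (n ℕ.∸ toℕ i)))
      ≈⟨ sumFin-cong (suc n) _ _ (λ i → leibniz (toℕ i) (ℕ.≤-pred (toℕ<n i))) ⟩
    sumFin R (suc n) (λ i → θ a (toℕ i) * b (n ℕ.∸ toℕ i) + a (toℕ i) * θ b (n ℕ.∸ toℕ i))
      ≈⟨ sumFin-+ (suc n) (λ i → θ a (toℕ i) * b (n ℕ.∸ toℕ i)) (λ i → a (toℕ i) * θ b (n ℕ.∸ toℕ i)) ⟩
    (θ a *ₚ b) n + (a *ₚ θ b) n ∎
    where
    open ≈-Reasoning
    open import Data.Fin.Properties using (toℕ<n)
    open IntegerRingSolver R using (solve; _:=_; _:+_; _:*_)
    leibniz : ∀ i → i ℕ.≤ n → (n × 1#) * (a i * b (n ℕ.∸ i)) ≈ θ a i * b (n ℕ.∸ i) + a i * θ b (n ℕ.∸ i)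
    leibniz i i≤n = begin
      (n × 1#) * (a i * b (n ℕ.∸ i))
        ≡⟨ ≡.cong (λ k → (k × 1#) * (a i * b (n ℕ.∸ i))) (ℕ.m+[n∸m]≡n i≤n) ⟨
      ((i ℕ.+ (n ℕ.∸ i)) × 1#) * (a i * b (n ℕ.∸ i))
        ≈⟨ *-congʳ (×-homo-+ 1# i (n ℕ.∸ i)) ⟩
      (i × 1# + (n ℕ.∸ i) × 1#) * (a i * b (n ℕ.∸ i))
        ≈⟨ solve 4 (λ x y u v → (x :+ y) :* (u :* v) := (x :* u) :* v :+ u :* (y :* v)) refl _ _ _ _ ⟩
      θ a i * b (n ℕ.∸ i) + a i * θ b (n ℕ.∸ i) ∎

  θ-mono : ∀ m → θ (monoₛ R m) ≋ ι m *ₚ monoₛ R m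
  θ-mono m n = trans (lemma n) (sym (κ-*ₚ (m × 1#) (monoₛ R m) n))
    where
    lemma : ∀ n → (n × 1#) * monoₛ R m n ≈ (m × 1#) * monoₛ R m n
    lemma n with m ℕ.≟ n
    ... | yes ≡.refl = refl
    ... | no _ = trans (zeroʳ _) (sym (zeroʳ _))

  θ-^ₚ : ∀ a p → θ (a ^ₚ suc p) ≋ ι (suc p) *ₚ (a ^ₚ p *ₚ θ a)
  θ-^ₚ a zero = begin
    θ (a *ₚ 𝟏)               ≈⟨ θ-*ₚ a 𝟏 ⟩
    θ a *ₚ 𝟏 +ₚ a *ₚ θ 𝟏     ≈⟨ +ₚ-cong (≋-refl {θ a *ₚ 𝟏}) (*ₚ-cong (≋-refl {a}) (θ-κ 1#)) ⟩
    θ a *ₚ 𝟏 +ₚ a *ₚ 𝟎       ≈⟨ solve 2 (λ t a → t :* t :^ 0 :+ a :* con (+ 0) := t :^ 0 :* (t :^ 0 :* t)) 𝕊.refl (θ a) a ⟩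
    𝟏 *ₚ (𝟏 *ₚ θ a)          ≈⟨ *ₚ-cong (κ-cong (sym (+-identityʳ 1#))) (≋-refl {𝟏 *ₚ θ a}) ⟩
    ι 1 *ₚ (𝟏 *ₚ θ a)        ∎
    where
    open ≋-Reasoning
    open IntegerRingSolver seriesRing using (solve; _:=_; _:+_; _:*_; _:^_; con)
    open import Data.Integer using (+_)
  θ-^ₚ a (suc p) = begin
    θ (a *ₚ a ^ₚ suc p)
      ≈⟨ θ-*ₚ a (a ^ₚ suc p) ⟩
    θ a *ₚ a ^ₚ suc p +ₚ a *ₚ θ (a ^ₚ suc p)
      ≈⟨ +ₚ-cong (≋-refl {θ a *ₚ a ^ₚ suc p}) (*ₚ-cong (≋-refl {a}) (θ-^ₚ a p)) ⟩
    θ a *ₚ a ^ₚ suc p +ₚ a *ₚ (ι (suc p) *ₚ (a ^ₚ p *ₚ θ a))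
      ≈⟨ solve 4 (λ a P t n → t :* (a :* P) :+ a :* (n :* (P :* t)) := (a :^ 0 :+ n) :* ((a :* P) :* t)) 𝕊.refl a (a ^ₚ p) (θ a) (ι (suc p)) ⟩
    (𝟏 +ₚ ι (suc p)) *ₚ (a ^ₚ suc p *ₚ θ a)
      ≈⟨ *ₚ-cong (≋-sym (κ-+ 1# (suc p × 1#))) (≋-refl {a ^ₚ suc p *ₚ θ a}) ⟩
    ι (suc (suc p)) *ₚ (a ^ₚ suc p *ₚ θ a) ∎
    where
    open ≋-Reasoning
    open IntegerRingSolver seriesRing using (solve; _:=_; _:+_; _:*_; _:^_)

  geometricSum-coeff₀ : ∀ n a b → (geometricSum n a b) 0 ≈ geometricSumᴿ n (a 0) (b 0)
  geometricSum-coeff₀ zero a b = refl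
  geometricSum-coeff₀ (suc n) a b = +-cong (^ₚ-coeff₀ a n) (trans (*ₚ-coeff₀ b (geometricSum n a b)) (*-congˡ (geometricSum-coeff₀ n a b)))

module Units {c ℓr : Level} (R : CommutativeRing c ℓr) (isField : IsFieldR R) where
  open CommutativeRing R
  open PowerSeries R
  open import Algebra.Properties.Semiring.Exp semiring using (_^_)
  open import Relation.Binary.Reasoning.Setoid setoid

  Invertible : Carrier → Set (c ⊔ ℓr)
  Invertible a = ∃ λ b → a * b ≈ 1#

  1≉0 : ¬ (1# ≈ 0#)
  1≉0 = proj₁ isField

  ≉0⇒invertible : ∀ {a} → ¬ (a ≈ 0#) → Invertible a
  ≉0⇒invertible = proj₂ isField _

  invertible⇒≉0 : ∀ {a} → Invertible a → ¬ (a ≈ 0#)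
  invertible⇒≉0 (b , ab≈1) a≈0 = 1≉0 (trans (sym ab≈1) (trans (*-congʳ a≈0) (zeroˡ b)))

  invertible-cancelʳ : ∀ {a b} → Invertible b → a * b ≈ 0# → a ≈ 0#
  invertible-cancelʳ {a} {b} (b⁻¹ , bb⁻¹≈1) ab≈0 = begin
    a             ≈⟨ *-identityʳ a ⟨
    a * 1#        ≈⟨ *-congˡ bb⁻¹≈1 ⟨
    a * (b * b⁻¹) ≈⟨ *-assoc a b b⁻¹ ⟨
    (a * b) * b⁻¹ ≈⟨ *-congʳ ab≈0 ⟩
    0# * b⁻¹      ≈⟨ zeroˡ b⁻¹ ⟩
    0#            ∎

  invertible-cancelˡ : ∀ {a b} → Invertible a → a * b ≈ 0# → b ≈ 0#
  invertible-cancelˡ a⁻¹ ab≈0 = invertible-cancelʳ a⁻¹ (trans (*-comm _ _) ab≈0)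

  invertible-cong : ∀ {a b} → a ≈ b → Invertible a → Invertible b
  invertible-cong a≈b (a⁻¹ , aa⁻¹≈1) = a⁻¹ , trans (*-congʳ (sym a≈b)) aa⁻¹≈1

  invertible-* : ∀ {a b} → Invertible a → Invertible b → Invertible (a * b)
  invertible-* {a} {b} (a⁻¹ , aa⁻¹≈1) (b⁻¹ , bb⁻¹≈1) = a⁻¹ * b⁻¹ , (begin
    (a * b) * (a⁻¹ * b⁻¹) ≈⟨ solve 4 (λ x y x′ y′ → (x :* y) :* (x′ :* y′) := (x :* x′) :* (y :* y′)) refl a b a⁻¹ b⁻¹ ⟩
    (a * a⁻¹) * (b * b⁻¹) ≈⟨ *-cong aa⁻¹≈1 bb⁻¹≈1 ⟩
    1# * 1#               ≈⟨ *-identityˡ 1# ⟩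
    1#                    ∎)
    where open IntegerRingSolver R using (solve; _:=_; _:*_)

  invertible-^ : ∀ {a} n → Invertible a → Invertible (a ^ n)
  invertible-^ zero _ = 1# , *-identityˡ 1#
  invertible-^ (suc n) a⁻¹ = invertible-* a⁻¹ (invertible-^ n a⁻¹)

  invertible-^⇒invertible : ∀ {a} n → Invertible (a ^ suc n) → Invertible a
  invertible-^⇒invertible {a} n (b , aⁿ⁺¹b≈1) = a ^ n * b , trans (sym (*-assoc a (a ^ n) b)) aⁿ⁺¹b≈1

  -1-invertible : Invertible (- 1#)
  -1-invertible = - 1# , trans (sym (-‿distribˡ-* 1# (- 1#))) (trans (-‿cong (*-identityˡ (- 1#))) (-‿involutive 1#))
    where open import Algebra.Properties.Ring ring using (-‿distribˡ-*; -‿involutive)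

  cancel-invertible-head : ∀ a b → Invertible (b 0) → a *ₚ b ≋ 𝟎 → a ≋ 𝟎
  cancel-invertible-head a b b₀⁻¹ ab≋0 n = trans (vanish-below (suc n) n ℕ.≤-refl) (sym (𝟎-coeff n))
    where
    vanish-at : ∀ j → (∀ i → i ℕ.< j → a i ≈ 0#) → a j ≈ 0#
    vanish-at j a<j≈0 = invertible-cancelʳ b₀⁻¹ (trans (sym (*ₚ-coeff-order a b j a<j≈0)) (trans (ab≋0 j) (𝟎-coeff j)))
    vanish-below : ∀ j i → i ℕ.< j → a i ≈ 0#
    vanish-below (suc j) i (s≤s i≤j) with ℕ.m≤n⇒m<n∨m≡n i≤j
    ... | inj₁ i<j = vanish-below j i i<j
    ... | inj₂ ≡.refl = vanish-at i (vanish-below i)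

module CharacteristicZero {c ℓr : Level} (R : CommutativeRing c ℓr) (isField : IsFieldR R) (char0 : CharZero R) where
  open CommutativeRing R
  open PowerSeries R
  open Units R isField
  open import Algebra.Properties.Semiring.Mult semiring using (_×_)
  open import Relation.Binary.Reasoning.Setoid setoid

  1+n×1≉0 : ∀ n → ¬ (suc n × 1# ≈ 0#)
  1+n×1≉0 n = ≡.subst (λ x → ¬ (x ≈ 0#)) (natR≡× (suc n)) (char0 n)

  ×1-injective : ∀ m n → m × 1# ≈ n × 1# → m ≡ n
  ×1-injective zero zero _ = ≡.refl
  ×1-injective zero (suc n) 0≈n+1 = contradiction (sym 0≈n+1) (1+n×1≉0 n)
  ×1-injective (suc m) zero m+1≈0 = contradiction m+1≈0 (1+n×1≉0 m)
  ×1-injective (suc m) (suc n) m+1≈n+1 = ≡.cong suc (×1-injective m n (+-cancelˡ 1# _ _ m+1≈n+1))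
    where open import Algebra.Properties.Ring ring using (+-cancelˡ)

  1+n×1-invertible : ∀ n → Invertible (suc n × 1#)
  1+n×1-invertible n = ≉0⇒invertible (1+n×1≉0 n)

  ×1-difference-invertible : ∀ m n → ¬ (m ≡ n) → Invertible (m × 1# - n × 1#)
  ×1-difference-invertible m n m≢n = ≉0⇒invertible λ m-n≈0 → m≢n (×1-injective m n (x∙y⁻¹≈ε⇒x≈y _ _ m-n≈0))
    where open import Algebra.Properties.Group +-group using (x∙y⁻¹≈ε⇒x≈y)

module KernelRoots {c ℓr : Level} (R : CommutativeRing c ℓr) (isField : IsFieldR R) (char0 : CharZero R)
                   (k ℓ₁ M : ℕ) (0<M : 0 Data.Nat.< M) where
  open CommutativeRing R
  open PowerSeries R
  open Units R isField
  open CharacteristicZero R isField char0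
  open import Algebra.Properties.Semiring.Mult semiring using (_×_; ×1-homo-*)
  open import Algebra.Properties.Semiring.Exp semiring using (_^_; ^-congˡ)

  ℓ : ℕ
  ℓ = suc ℓ₁

  X : PS R
  X = monoₛ R M

  IsSolution : PS R → Set ℓr
  IsSolution w = (w -ₚ 𝟏) ^ₚ ℓ ≋ X *ₚ w ^ₚ (k ℕ.+ ℓ)

  module Solution (w : PS R) (solution : IsSolution w) where
    v U : PS R
    v = w -ₚ 𝟏
    U = w ^ₚ (k ℕ.+ ℓ)

    w₀-invertible : Invertible (w 0)
    w₀-invertible = ≉0⇒invertible λ w₀≈0 → invertible⇒≉0 (invertible-^ ℓ -1-invertible) (begin
      (- 1#) ^ ℓ    ≈⟨ ^-congˡ ℓ (trans (+-congʳ w₀≈0) (+-identityˡ (- 1#))) ⟨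
      v 0 ^ ℓ       ≈⟨ ^ₚ-coeff₀ v ℓ ⟨
      (v ^ₚ ℓ) 0    ≈⟨ solution 0 ⟩
      (X *ₚ U) 0    ≈⟨ mono-*ₚ-below M U 0 0<M ⟩
      0#            ∎)
      where open ≈-Reasoning

    U₀-invertible : Invertible (U 0)
    U₀-invertible = invertible-cong (sym (^ₚ-coeff₀ w (k ℕ.+ ℓ))) (invertible-^ (k ℕ.+ ℓ) w₀-invertible)

    -- multiplying θ(vˡ) = ℓ vˡ⁻¹ θv by v gives ℓ vˡ θv = ℓ X U θv
    θ-identity : ι ℓ *ₚ (U *ₚ θ v) ≋ ι M *ₚ (v *ₚ U) +ₚ v *ₚ θ U
    θ-identity = mono-cancel M (begin
      X *ₚ (ι ℓ *ₚ (U *ₚ θ v))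
        ≈⟨ solve 4 (λ x N u t → x :* (N :* (u :* t)) := N :* ((x :* u) :* t)) 𝕊.refl X (ι ℓ) U (θ v) ⟩
      ι ℓ *ₚ ((X *ₚ U) *ₚ θ v)
        ≈⟨ *ₚ-cong (≋-refl {ι ℓ}) (*ₚ-cong solution (≋-refl {θ v})) ⟨
      ι ℓ *ₚ (v ^ₚ ℓ *ₚ θ v)
        ≈⟨ solve 4 (λ v N P t → N :* ((v :* P) :* t) := v :* (N :* (P :* t))) 𝕊.refl v (ι ℓ) (v ^ₚ ℓ₁) (θ v) ⟩
      v *ₚ (ι ℓ *ₚ (v ^ₚ ℓ₁ *ₚ θ v))
        ≈⟨ *ₚ-cong (≋-refl {v}) (θ-^ₚ v ℓ₁) ⟨
      v *ₚ θ (v ^ₚ ℓ)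
        ≈⟨ *ₚ-cong (≋-refl {v}) (θ-cong solution) ⟩
      v *ₚ θ (X *ₚ U)
        ≈⟨ *ₚ-cong (≋-refl {v}) (θ-*ₚ X U) ⟩
      v *ₚ (θ X *ₚ U +ₚ X *ₚ θ U)
        ≈⟨ *ₚ-cong (≋-refl {v}) (+ₚ-cong (*ₚ-cong (θ-mono M) (≋-refl {U})) (≋-refl {X *ₚ θ U})) ⟩
      v *ₚ ((ι M *ₚ X) *ₚ U +ₚ X *ₚ θ U)
        ≈⟨ solve 5 (λ v N x u t → v :* ((N :* x) :* u :+ x :* t) := x :* (N :* (v :* u) :+ v :* t)) 𝕊.refl v (ι M) X U (θ U) ⟩
      X *ₚ (ι M *ₚ (v *ₚ U) +ₚ v *ₚ θ U)   ∎)
      where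
      open ≋-Reasoning
      open IntegerRingSolver seriesRing using (solve; _:=_; _:+_; _:*_)

    -- comparing the coefficients of tʲ in θ-identity gives (ℓ j - M) vⱼ U₀ = 0
    coefficient-vanishes : ∀ j → ¬ ℓ ℕ.* j ≡ M → (∀ i → i ℕ.< j → v i ≈ 0#) → v j ≈ 0#
    coefficient-vanishes j ℓj≢M v<j≈0 = invertible-cancelʳ U₀-invertible
      (invertible-cancelˡ (×1-difference-invertible (ℓ ℕ.* j) M ℓj≢M) (begin
        ((ℓ ℕ.* j) × 1# - M × 1#) * (v j * U 0)
          ≈⟨ *-congʳ (+-congʳ (×1-homo-* ℓ j)) ⟩
        (ℓ × 1# * j × 1# - M × 1#) * (v j * U 0)
          ≈⟨ solve 5 (λ L J N x u → (L :* J :- N) :* (x :* u) := L :* ((J :* x) :* u) :- N :* (x :* u)) refl (ℓ × 1#) (j × 1#) (M × 1#) (v j) (U 0) ⟩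
        ℓ × 1# * (θ v j * U 0) - M × 1# * (v j * U 0)
          ≈⟨ +-cong lhs (-‿cong rhs) ⟨
        (ι ℓ *ₚ (U *ₚ θ v)) j - (ι M *ₚ (v *ₚ U) +ₚ v *ₚ θ U) j
          ≈⟨ +-congʳ (θ-identity j) ⟩
        (ι M *ₚ (v *ₚ U) +ₚ v *ₚ θ U) j - (ι M *ₚ (v *ₚ U) +ₚ v *ₚ θ U) j
          ≈⟨ -‿inverseʳ _ ⟩
        0#                                                           ∎))
      where
      open ≈-Reasoning
      open IntegerRingSolver R using (solve; _:=_; _:+_; _:*_; _:-_)
      lhs : (ι ℓ *ₚ (U *ₚ θ v)) j ≈ ℓ × 1# * (θ v j * U 0)
      lhs = trans (κ-*ₚ (ℓ × 1#) (U *ₚ θ v) j) (*-congˡ (trans (*ₚ-comm U (θ v) j)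
        (*ₚ-coeff-order (θ v) U j (λ i i<j → trans (*-congˡ (v<j≈0 i i<j)) (zeroʳ _)))))
      rhs : (ι M *ₚ (v *ₚ U) +ₚ v *ₚ θ U) j ≈ M × 1# * (v j * U 0)
      rhs = trans (+-cong (trans (κ-*ₚ (M × 1#) (v *ₚ U) j) (*-congˡ (*ₚ-coeff-order v U j v<j≈0)))
                          (trans (*ₚ-coeff-order v (θ U) j v<j≈0) (trans (*-congˡ (zeroˡ (U 0))) (zeroʳ (v j)))))
                  (+-identityʳ _)

    vanish-below : ∀ j → (∀ i → i ℕ.< j → ¬ ℓ ℕ.* i ≡ M) → ∀ i → i ℕ.< j → v i ≈ 0#
    vanish-below (suc j) ℓi≢M i (s≤s i≤j) with ℕ.m≤n⇒m<n∨m≡n i≤j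
    ... | inj₁ i<j = vanish-below j (λ i′ i′<j → ℓi≢M i′ (ℕ.m≤n⇒m≤1+n i′<j)) i i<j
    ... | inj₂ ≡.refl = coefficient-vanishes i (ℓi≢M i ℕ.≤-refl) (vanish-below i (λ i′ i′<i → ℓi≢M i′ (ℕ.m≤n⇒m≤1+n i′<i)))

    ℓ∣M : ℓ ∣ M
    ℓ∣M with ℓ ∣? M
    ... | yes ℓ∣M = ℓ∣M
    ... | no ℓ∤M = contradiction U₀≈0 (invertible⇒≉0 U₀-invertible)
      where
      v≋𝟎 : v ≋ 𝟎
      v≋𝟎 n = trans (vanish-below (suc n) (λ i _ ℓi≡M → ℓ∤M (divides i (≡.trans (≡.sym ℓi≡M) (ℕ.*-comm ℓ i)))) n ℕ.≤-refl)
                    (sym (𝟎-coeff n))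
      U≋𝟎 : U ≋ 𝟎
      U≋𝟎 = mono-cancel M (≋-trans (≋-sym solution)
        (≋-trans (*ₚ-cong v≋𝟎 (≋-refl {v ^ₚ ℓ₁})) (≋-trans (𝕊.zeroˡ (v ^ₚ ℓ₁)) (≋-sym (𝕊.zeroʳ X)))))
      U₀≈0 : U 0 ≈ 0#
      U₀≈0 = U≋𝟎 0

    module Leading (m : ℕ) (M≡mℓ : M ≡ m ℕ.* ℓ) where

      0<m : 0 ℕ.< m
      0<m = ℕ.n≢0⇒n>0 λ { ≡.refl → ℕ.<-irrefl (≡.sym M≡mℓ) 0<M }

      v-order : ∀ i → i ℕ.< m → v i ≈ 0#
      v-order = vanish-below m λ i i<m ℓi≡M → ℕ.<-irrefl (≡.trans ℓi≡M (≡.trans M≡mℓ (ℕ.*-comm m ℓ))) (ℕ.*-monoʳ-< ℓ i<m)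

      y : PS R
      y = drop m v

      v≋tᵐy : v ≋ monoₛ R m *ₚ y
      v≋tᵐy = factor-order m v v-order

      y^ℓ≋U : y ^ₚ ℓ ≋ U
      y^ℓ≋U = mono-cancel (m ℕ.* ℓ) (begin
        monoₛ R (m ℕ.* ℓ) *ₚ y ^ₚ ℓ   ≈⟨ *ₚ-cong (mono-^ m ℓ) (≋-refl {y ^ₚ ℓ}) ⟨
        monoₛ R m ^ₚ ℓ *ₚ y ^ₚ ℓ      ≈⟨ ^ₚ-distrib-*ₚ (monoₛ R m) y ℓ ⟨
        (monoₛ R m *ₚ y) ^ₚ ℓ         ≈⟨ ^ₚ-congˡ ℓ v≋tᵐy ⟨
        v ^ₚ ℓ                        ≈⟨ solution ⟩
        X *ₚ U                        ≡⟨ ≡.cong (λ M′ → monoₛ R M′ *ₚ U) M≡mℓ ⟩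
        monoₛ R (m ℕ.* ℓ) *ₚ U        ∎)
        where open ≋-Reasoning

      y₀-invertible : Invertible (y 0)
      y₀-invertible = invertible-^⇒invertible ℓ₁ (invertible-cong (trans (sym (y^ℓ≋U 0)) (^ₚ-coeff₀ y ℓ)) U₀-invertible)

  module SolutionPair (m : ℕ) (M≡mℓ : M ≡ m ℕ.* ℓ) (w w′ : PS R) (sol : IsSolution w) (sol′ : IsSolution w′) where
    open Solution w sol using (U; module Leading)
    open Leading m M≡mℓ using (y; v≋tᵐy; y^ℓ≋U; y₀-invertible; 0<m)
    open Solution w′ sol′ using () renaming (U to U′; module Leading to Leading′)
    open Leading′ m M≡mℓ using () renaming (y to y′; v≋tᵐy to v′≋tᵐy′; y^ℓ≋U to y′^ℓ≋U′)
    open CommutativeRingIdentities R using (geometricSum-cong; geometricSum-diagonal) renaming (geometricSum to geometricSumᴿ)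
    open IntegerRingSolver seriesRing using (solve; _:=_; _:+_; _:*_; _:-_)

    w-w′≋tᵐ[y-y′] : w -ₚ w′ ≋ monoₛ R m *ₚ (y -ₚ y′)
    w-w′≋tᵐ[y-y′] = begin
      w -ₚ w′                             ≈⟨ solve 3 (λ w w′ o → w :- w′ := (w :- o) :- (w′ :- o)) 𝕊.refl w w′ 𝟏 ⟩
      (w -ₚ 𝟏) -ₚ (w′ -ₚ 𝟏)               ≈⟨ +ₚ-cong v≋tᵐy (-ₚ-cong v′≋tᵐy′) ⟩
      monoₛ R m *ₚ y -ₚ monoₛ R m *ₚ y′   ≈⟨ solve 3 (λ t y y′ → t :* y :- t :* y′ := t :* (y :- y′)) 𝕊.refl (monoₛ R m) y y′ ⟩
      monoₛ R m *ₚ (y -ₚ y′)              ∎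
      where open ≋-Reasoning

    β : PS R
    β = geometricSum ℓ y y′ -ₚ monoₛ R m *ₚ geometricSum (k ℕ.+ ℓ) w w′

    -- (y - y′) G(y, y′) and (w - w′) G(w, w′) are both U - U′
    [y-y′]β≋𝟎 : (y -ₚ y′) *ₚ β ≋ 𝟎
    [y-y′]β≋𝟎 = begin
      (y -ₚ y′) *ₚ β
        ≈⟨ solve 4 (λ d G t H → d :* (G :- t :* H) := d :* G :- (t :* d) :* H) 𝕊.refl (y -ₚ y′) (geometricSum ℓ y y′) (monoₛ R m) Gw ⟩
      (y -ₚ y′) *ₚ geometricSum ℓ y y′ -ₚ (monoₛ R m *ₚ (y -ₚ y′)) *ₚ Gw
        ≈⟨ +ₚ-cong (≋-sym (^-difference ℓ y y′)) (-ₚ-cong (*ₚ-cong (≋-sym w-w′≋tᵐ[y-y′]) (≋-refl {Gw}))) ⟩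
      y ^ₚ ℓ -ₚ y′ ^ₚ ℓ -ₚ (w -ₚ w′) *ₚ Gw
        ≈⟨ +ₚ-cong (+ₚ-cong y^ℓ≋U (-ₚ-cong y′^ℓ≋U′)) (-ₚ-cong (≋-sym (^-difference (k ℕ.+ ℓ) w w′))) ⟩
      U -ₚ U′ -ₚ (U -ₚ U′)
        ≈⟨ 𝕊.-‿inverseʳ (U -ₚ U′) ⟩
      𝟎 ∎
      where
      open ≋-Reasoning
      Gw = geometricSum (k ℕ.+ ℓ) w w′

    β₀ : β 0 ≈ geometricSumᴿ ℓ (y 0) (y′ 0)
    β₀ = trans (+-cong (geometricSum-coeff₀ ℓ y y′) (-‿cong (mono-*ₚ-below m (geometricSum (k ℕ.+ ℓ) w w′) 0 0<m)))
      (trans (+-congˡ -0#≈0#) (+-identityʳ _))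
      where open import Algebra.Properties.Ring ring using (-0#≈0#)

    equal-leading⇒≋ : y 0 ≈ y′ 0 → w ≋ w′
    equal-leading⇒≋ y₀≈y′₀ = x∙y⁻¹≈ε⇒x≈y w w′ w-w′≋𝟎
      where
      open import Algebra.Properties.Group 𝕊.+-group using (x∙y⁻¹≈ε⇒x≈y)
      β₀-invertible : Invertible (β 0)
      β₀-invertible = invertible-cong
        (sym (trans β₀ (trans (geometricSum-cong ℓ refl (sym y₀≈y′₀)) (geometricSum-diagonal ℓ₁ (y 0)))))
        (invertible-* (1+n×1-invertible ℓ₁) (invertible-^ ℓ₁ y₀-invertible))
      w-w′≋𝟎 : w -ₚ w′ ≋ 𝟎
      w-w′≋𝟎 = ≋-trans w-w′≋tᵐ[y-y′] (≋-trans (*ₚ-cong (≋-refl {monoₛ R m}) y-y′≋𝟎) (𝕊.zeroʳ (monoₛ R m)))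
        where y-y′≋𝟎 = cancel-invertible-head (y -ₚ y′) β β₀-invertible [y-y′]β≋𝟎

    distinct⇒cancellative : ¬ w ≋ w′ → ∀ q → (w -ₚ w′) *ₚ q ≋ 𝟎 → q ≋ 𝟎
    distinct⇒cancellative w≉w′ q [w-w′]q≋𝟎 = cancel-invertible-head q (y -ₚ y′) leading-invertible
      (≋-trans (*ₚ-comm q (y -ₚ y′)) (mono-cancel m (≋-trans shifted (≋-sym (𝕊.zeroʳ (monoₛ R m))))))
      where
      leading-invertible : Invertible (y 0 - y′ 0)
      leading-invertible = ≉0⇒invertible λ d≈0 → w≉w′ (equal-leading⇒≋ (x∙y⁻¹≈ε⇒x≈y (y 0) (y′ 0) d≈0))
        where open import Algebra.Properties.Group +-group using (x∙y⁻¹≈ε⇒x≈y)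
      shifted : monoₛ R m *ₚ ((y -ₚ y′) *ₚ q) ≋ 𝟎
      shifted = ≋-trans (≋-sym (𝕊.*-assoc (monoₛ R m) (y -ₚ y′) q)) (≋-trans (*ₚ-cong (≋-sym w-w′≋tᵐ[y-y′]) (≋-refl {q})) [w-w′]q≋𝟎)

module SeriesInX {c ℓr : Level} (R : CommutativeRing c ℓr) (M : ℕ) .{{_ : NonZero M}} where
  open CommutativeRing R
  open PowerSeries R
  open import Algebra.Properties.Semiring.Mult semiring using (_×_)
  open import Data.Nat.DivMod using (_/_; _%_; m<n⇒m%n≡m; m<n⇒m/n≡0; [m+n]%n≡m%n; +-distrib-/-∣ʳ; n/n≡1)
  open import Data.Nat.Divisibility using (∣-refl)

  X : PS R
  X = monoₛ R M

  0<M : 0 ℕ.< M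
  0<M = ℕ.>-nonZero⁻¹ M

  private
    inX-divisible : ∀ g m → m % M ≡ 0 → inXₛ R M g m ≈ g (m / M) × 1#
    inX-divisible g m m%M≡0 rewrite m%M≡0 = reflexive (natR≡× (g (m / M)))

    inX-indivisible : ∀ g m d → m % M ≡ suc d → inXₛ R M g m ≈ 0#
    inX-indivisible g m d m%M≡1+d rewrite m%M≡1+d = refl

    [M+n]%M≡n%M : ∀ n → (M ℕ.+ n) % M ≡ n % M
    [M+n]%M≡n%M n = ≡.trans (≡.cong (_% M) (ℕ.+-comm M n)) ([m+n]%n≡m%n n M)

    [M+n]/M≡1+n/M : ∀ n → (M ℕ.+ n) / M ≡ suc (n / M)
    [M+n]/M≡1+n/M n = ≡.trans (≡.cong (_/ M) (ℕ.+-comm M n))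
      (≡.trans (+-distrib-/-∣ʳ n ∣-refl) (≡.trans (≡.cong (n / M ℕ.+_) (n/n≡1 M)) (ℕ.+-comm (n / M) 1)))

  inX-cong : ∀ {g g′} → (∀ n → g n ≡ g′ n) → inXₛ R M g ≋ inXₛ R M g′
  inX-cong {g} g≗g′ m with m % M
  ... | zero = reflexive (≡.cong (natR R) (g≗g′ (m / M)))
  ... | suc _ = refl

  inX-below : ∀ g m → m ℕ.< M → inXₛ R M g m ≈ ι (g 0) m
  inX-below g zero 0<M = trans (inX-divisible g 0 (m<n⇒m%n≡m 0<M)) (reflexive (≡.cong (λ j → g j × 1#) (m<n⇒m/n≡0 0<M)))
  inX-below g (suc m) m<M = inX-indivisible g (suc m) m (m<n⇒m%n≡m m<M)

  inX-above : ∀ g n → inXₛ R M g (M ℕ.+ n) ≈ inXₛ R M (λ j → g (suc j)) n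
  inX-above g n with n % M in n%M≡
  ... | zero = trans (inX-divisible g (M ℕ.+ n) (≡.trans ([M+n]%M≡n%M n) n%M≡))
    (reflexive (≡.trans (≡.cong (λ j → g j × 1#) ([M+n]/M≡1+n/M n)) (≡.sym (natR≡× (g (suc (n / M)))))))
  ... | suc d = inX-indivisible g (M ℕ.+ n) d (≡.trans ([M+n]%M≡n%M n) n%M≡)

  inX-step : ∀ g → inXₛ R M g ≋ ι (g 0) +ₚ X *ₚ inXₛ R M (λ j → g (suc j))
  inX-step g m with m ℕ.<? M
  ... | yes m<M = trans (inX-below g m m<M) (sym (trans (+-congˡ (mono-*ₚ-below M (inXₛ R M g′) m m<M)) (+-identityʳ _)))
    where g′ = λ j → g (suc j)
  ... | no m≮M = ≡.subst (λ i → inXₛ R M g i ≈ (ι (g 0) +ₚ X *ₚ inXₛ R M g′) i) (ℕ.m+[n∸m]≡n (ℕ.≮⇒≥ m≮M)) (sym (begin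
    ι (g 0) (M ℕ.+ n) + (X *ₚ inXₛ R M g′) (M ℕ.+ n)
      ≈⟨ +-cong (κ-coeff>0 _ (M ℕ.+ n) (ℕ.<-≤-trans 0<M (ℕ.m≤m+n M n))) (mono-*ₚ M (inXₛ R M g′) (M ℕ.+ n)) ⟩
    0# + shiftBy M (inXₛ R M g′) (M ℕ.+ n)
      ≈⟨ +-identityˡ _ ⟩
    shiftBy M (inXₛ R M g′) (M ℕ.+ n)
      ≡⟨ shiftBy-above M (inXₛ R M g′) n ⟩
    inXₛ R M g′ n
      ≈⟨ inX-above g n ⟨
    inXₛ R M g (M ℕ.+ n)                                 ∎))
    where
    open ≈-Reasoning
    g′ = λ j → g (suc j)
    n = m ℕ.∸ M

module KernelIdentity {c ℓr : Level} (R : CommutativeRing c ℓr) (k ℓ M : ℕ) .{{_ : NonZero M}} where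
  open CommutativeRing R using (refl; trans; sym; reflexive)
  open PowerSeries R
  open SeriesInX R M
  open CommutativeRingIdentities seriesRing using (evalℕ; evalℕ-pad; evalℕ-fold-suffixSums; remainder; remainder-cong; remainder-linear)
  open IntegerRingSolver seriesRing using (solve; _:=_; _:+_; _:*_; _:-_; _:^_; con)
  open import Data.Integer using (+_)
  open ≋-Reasoning

  entryCount : ℕ → ℕ → ℕ
  entryCount j i = sumℕ (fold (columnEntries k ℓ j) suffixSums i)

  a : ℕ → PS R
  a i = inXₛ R M (λ j → entryCount j i)

  aFrom : ℕ → ℕ → PS R
  aFrom J i = inXₛ R M (λ j → entryCount (J ℕ.+ j) i)

  aFrom-step : ∀ J i → aFrom J i ≋ ι (entryCount J i) +ₚ X *ₚ aFrom (suc J) i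
  aFrom-step J i = ≋-trans (inX-step (λ j → entryCount (J ℕ.+ j) i))
    (+ₚ-cong (λ n → reflexive (≡.cong (λ j → ι (entryCount j i) n) (ℕ.+-identityʳ J)))
             (*ₚ-cong (≋-refl {X}) (inX-cong (λ j → ≡.cong (λ j′ → entryCount j′ i) (ℕ.+-suc J j)))))

  module _ (w : PS R) (solution : (w -ₚ 𝟏) ^ₚ ℓ ≋ X *ₚ w ^ₚ (k ℕ.+ ℓ)) where

    Q : ℕ → PS R
    Q J = evalℕ (columnEntries k ℓ J) w

    w^[k+ℓ]≋w^ℓQ₀ : w ^ₚ (k ℕ.+ ℓ) ≋ w ^ₚ ℓ *ₚ Q 0
    w^[k+ℓ]≋w^ℓQ₀ = begin
      w ^ₚ (k ℕ.+ ℓ)                          ≈⟨ ^ₚ-homo-*ₚ w k ℓ ⟩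
      w ^ₚ k *ₚ w ^ₚ ℓ                        ≈⟨ solve 2 (λ A B → A :* B := B :* (A :* B :^ 0)) 𝕊.refl (w ^ₚ k) (w ^ₚ ℓ) ⟩
      w ^ₚ ℓ *ₚ (w ^ₚ k *ₚ 𝟏)                 ≈⟨ *ₚ-cong (≋-refl {w ^ₚ ℓ}) (*ₚ-cong (≋-refl {w ^ₚ k}) evalℕ-[1]) ⟨
      w ^ₚ ℓ *ₚ (w ^ₚ k *ₚ evalℕ (1 ∷ []) w)  ≈⟨ *ₚ-cong (≋-refl {w ^ₚ ℓ}) (evalℕ-pad k (1 ∷ []) w) ⟨
      w ^ₚ ℓ *ₚ Q 0                           ∎
      where
      evalℕ-[1] : evalℕ (1 ∷ []) w ≋ 𝟏
      evalℕ-[1] = solve 1 (λ x → (x :^ 0 :+ con (+ 0)) :+ x :* con (+ 0) := x :^ 0) 𝕊.refl w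

    Rem : ℕ → PS R
    Rem J = remainder ℓ (aFrom J) w

    block-step : ∀ J → w ^ₚ ℓ *ₚ Q J -ₚ Rem J ≋ X *ₚ (w ^ₚ ℓ *ₚ Q (suc J) -ₚ Rem (suc J))
    block-step J = begin
      w ^ₚ ℓ *ₚ Q J -ₚ Rem J
        ≈⟨ +ₚ-cong (≋-refl {w ^ₚ ℓ *ₚ Q J}) (-ₚ-cong split) ⟩
      w ^ₚ ℓ *ₚ Q J -ₚ (Cᴶ +ₚ X *ₚ Rem (suc J))
        ≈⟨ solve 3 (λ A B C → A :- (B :+ C) := (A :- B) :- C) 𝕊.refl (w ^ₚ ℓ *ₚ Q J) Cᴶ (X *ₚ Rem (suc J)) ⟩
      (w ^ₚ ℓ *ₚ Q J -ₚ Cᴶ) -ₚ X *ₚ Rem (suc J)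
        ≈⟨ +ₚ-cong (≋-sym (evalℕ-fold-suffixSums ℓ (columnEntries k ℓ J) w)) (≋-refl { -ₚ (X *ₚ Rem (suc J))}) ⟩
      (w -ₚ 𝟏) ^ₚ ℓ *ₚ Gᴶ -ₚ X *ₚ Rem (suc J)
        ≈⟨ +ₚ-cong (*ₚ-cong solution (≋-refl {Gᴶ})) (≋-refl { -ₚ (X *ₚ Rem (suc J))}) ⟩
      (X *ₚ w ^ₚ (k ℕ.+ ℓ)) *ₚ Gᴶ -ₚ X *ₚ Rem (suc J)
        ≈⟨ +ₚ-cong (*ₚ-cong (*ₚ-cong (≋-refl {X}) (^ₚ-homo-*ₚ w k ℓ)) (≋-refl {Gᴶ})) (≋-refl { -ₚ (X *ₚ Rem (suc J))}) ⟩
      (X *ₚ (w ^ₚ k *ₚ w ^ₚ ℓ)) *ₚ Gᴶ -ₚ X *ₚ Rem (suc J)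
        ≈⟨ solve 5 (λ x A B G Rm → (x :* (A :* B)) :* G :- x :* Rm := x :* (B :* (A :* G) :- Rm)) 𝕊.refl X (w ^ₚ k) (w ^ₚ ℓ) Gᴶ (Rem (suc J)) ⟩
      X *ₚ (w ^ₚ ℓ *ₚ (w ^ₚ k *ₚ Gᴶ) -ₚ Rem (suc J))
        ≈⟨ *ₚ-cong (≋-refl {X}) (+ₚ-cong (*ₚ-cong (≋-refl {w ^ₚ ℓ}) (evalℕ-pad k (fold (columnEntries k ℓ J) suffixSums ℓ) w)) (≋-refl { -ₚ Rem (suc J)})) ⟨
      X *ₚ (w ^ₚ ℓ *ₚ Q (suc J) -ₚ Rem (suc J)) ∎
      where
      Cᴶ = remainder ℓ (λ i → entryCount J i ×ₚ 𝟏) w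
      Gᴶ = evalℕ (fold (columnEntries k ℓ J) suffixSums ℓ) w
      split : Rem J ≋ Cᴶ +ₚ X *ₚ Rem (suc J)
      split = ≋-trans (remainder-cong ℓ w (λ i → ≋-trans (aFrom-step J i) (+ₚ-cong (ι≋× (entryCount J i)) (≋-refl {X *ₚ aFrom (suc J) i}))))
                      (remainder-linear ℓ (λ i → entryCount J i ×ₚ 𝟏) (aFrom (suc J)) X w)

    telescoped : ∀ J → (w -ₚ 𝟏) ^ₚ ℓ -ₚ X *ₚ remainder ℓ a w ≋ X ^ₚ suc J *ₚ (w ^ₚ ℓ *ₚ Q J -ₚ Rem J)
    telescoped zero = begin
      (w -ₚ 𝟏) ^ₚ ℓ -ₚ X *ₚ Rem 0
        ≈⟨ +ₚ-cong (≋-trans solution (*ₚ-cong (≋-refl {X}) w^[k+ℓ]≋w^ℓQ₀)) (≋-refl { -ₚ (X *ₚ Rem 0)}) ⟩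
      X *ₚ (w ^ₚ ℓ *ₚ Q 0) -ₚ X *ₚ Rem 0
        ≈⟨ solve 3 (λ x A Rm → x :* A :- x :* Rm := (x :* x :^ 0) :* (A :- Rm)) 𝕊.refl X (w ^ₚ ℓ *ₚ Q 0) (Rem 0) ⟩
      X ^ₚ 1 *ₚ (w ^ₚ ℓ *ₚ Q 0 -ₚ Rem 0) ∎
    telescoped (suc J) = begin
      (w -ₚ 𝟏) ^ₚ ℓ -ₚ X *ₚ remainder ℓ a w
        ≈⟨ telescoped J ⟩
      X ^ₚ suc J *ₚ (w ^ₚ ℓ *ₚ Q J -ₚ Rem J)
        ≈⟨ *ₚ-cong (≋-refl {X ^ₚ suc J}) (block-step J) ⟩
      X ^ₚ suc J *ₚ (X *ₚ (w ^ₚ ℓ *ₚ Q (suc J) -ₚ Rem (suc J)))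
        ≈⟨ solve 3 (λ P x S → P :* (x :* S) := (x :* P) :* S) 𝕊.refl (X ^ₚ suc J) X (w ^ₚ ℓ *ₚ Q (suc J) -ₚ Rem (suc J)) ⟩
      X ^ₚ suc (suc J) *ₚ (w ^ₚ ℓ *ₚ Q (suc J) -ₚ Rem (suc J)) ∎

    -- the left side is divisible by every power of X, so each coefficient vanishes
    kernel-identity : (w -ₚ 𝟏) ^ₚ ℓ -ₚ X *ₚ remainder ℓ a w ≋ 𝟎
    kernel-identity n = trans (telescoped n n) (trans (*ₚ-cong (mono-^ M (suc n)) (≋-refl {S}) n)
      (trans (mono-*ₚ-below (M ℕ.* suc n) S n n<M[1+n]) (sym (𝟎-coeff n))))
      where
      S = w ^ₚ ℓ *ₚ Q n -ₚ Rem n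
      n<M[1+n] : n ℕ.< M ℕ.* suc n
      n<M[1+n] = ℕ.<-≤-trans (ℕ.n<1+n n) (ℕ.m≤n*m (suc n) M {{ℕ.>-nonZero 0<M}})

module RightHandSide {c ℓr : Level} (R : CommutativeRing c ℓr) where
  open CommutativeRing R using (_≈_)
  open PowerSeries R
  open CommutativeRingIdentities seriesRing using (except; ∑∏-except)
  open import Algebra.Properties.Semiring.Sum 𝕊.semiring using (sum; sum-cong-≋)
  import Algebra.Properties.Monoid.Sum 𝕊.*-monoid as ∏
  open ∏ using () renaming (sum to product)

  sumₛ≡sum : ∀ n (f : Fin n → PS R) → sumₛ R n f ≡ sum f
  sumₛ≡sum zero f = ≡.refl
  sumₛ≡sum (suc n) f = ≡.cong (f fzero +ₚ_) (sumₛ≡sum n (λ i → f (fsuc i)))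

  prodₛ≡product : ∀ n (f : Fin n → PS R) → prodₛ R n f ≡ product f
  prodₛ≡product zero f = ≡.refl
  prodₛ≡product (suc n) f = ≡.cong (f fzero *ₚ_) (prodₛ≡product n (λ i → f (fsuc i)))

  -- the factors of the i-th product in RHS are given by a helper from its where block, which
  -- can only be named through unification
  RHS-shape : ∀ ℓ (w : Fin ℓ → PS R) → Σ (Fin ℓ → Fin ℓ → PS R) λ omit →
    RHS R ℓ w ≡ (𝟏 +ₚ κ (natR R (ℓ ℕ.∸ 1)) *ₚ prodₛ R ℓ (λ j → 𝟏 -ₚ w j)) -ₚ sumₛ R ℓ (λ i → prodₛ R ℓ (omit i))
  RHS-shape ℓ w = _ , ≡.refl

  RHS-omit≋except : ∀ ℓ (w : Fin ℓ → PS R) i j → proj₁ (RHS-shape ℓ w) i j ≋ except (λ j → 𝟏 -ₚ w j) i j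
  RHS-omit≋except ℓ w i j with i ≟ j
  ... | yes _ = ≋-refl
  ... | no _ = ≋-refl

  RHS≋ : ∀ ℓ (w : Fin ℓ → PS R) →
    RHS R ℓ w ≋ (𝟏 +ₚ ι (ℓ ℕ.∸ 1) *ₚ product (λ j → 𝟏 -ₚ w j)) -ₚ ∑∏-except (λ j → 𝟏 -ₚ w j)
  RHS≋ ℓ w = begin
    RHS R ℓ w
      ≡⟨ proj₂ (RHS-shape ℓ w) ⟩
    (𝟏 +ₚ ℓ-1 *ₚ prodₛ R ℓ (λ j → 𝟏 -ₚ w j)) -ₚ sumₛ R ℓ (λ i → prodₛ R ℓ (omit i))
      ≡⟨ ≡.cong₂ (λ P E → (𝟏 +ₚ ℓ-1 *ₚ P) -ₚ E) (prodₛ≡product ℓ _) (sumₛ≡sum ℓ _) ⟩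
    (𝟏 +ₚ ℓ-1 *ₚ product (λ j → 𝟏 -ₚ w j)) -ₚ sum (λ i → prodₛ R ℓ (omit i))
      ≈⟨ +ₚ-cong (≋-refl {𝟏 +ₚ ℓ-1 *ₚ product (λ j → 𝟏 -ₚ w j)}) (-ₚ-cong (sum-cong-≋ omit≋except)) ⟩
    (𝟏 +ₚ ℓ-1 *ₚ product (λ j → 𝟏 -ₚ w j)) -ₚ ∑∏-except (λ j → 𝟏 -ₚ w j)
      ≈⟨ +ₚ-cong (+ₚ-cong (≋-refl {𝟏}) (*ₚ-cong (κnatR≋ι (ℓ ℕ.∸ 1)) (≋-refl {product (λ j → 𝟏 -ₚ w j)})))
                 (≋-refl { -ₚ ∑∏-except (λ j → 𝟏 -ₚ w j)}) ⟩
    (𝟏 +ₚ ι (ℓ ℕ.∸ 1) *ₚ product (λ j → 𝟏 -ₚ w j)) -ₚ ∑∏-except (λ j → 𝟏 -ₚ w j) ∎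
    where
    open ≋-Reasoning
    ℓ-1 = κ (natR R (ℓ ℕ.∸ 1))
    omit = proj₁ (RHS-shape ℓ w)
    omit≋except : ∀ i → prodₛ R ℓ (omit i) ≋ product (except (λ j → 𝟏 -ₚ w j) i)
    omit≋except i = ≋-trans (𝕊.reflexive (prodₛ≡product ℓ (omit i))) (∏.sum-cong-≋ (RHS-omit≋except ℓ w i))

module KernelMethod {c ℓr : Level} (R : CommutativeRing c ℓr) (isField : IsFieldR R) (char0 : CharZero R)
                    (k ℓ₂ M : ℕ) .{{_ : NonZero M}} where
  open CommutativeRing R using (_≈_; 1#; +-identityʳ)
  open import Data.Vec using (Vec; map)
  open PowerSeries R
  open SeriesInX R M public using (X)
  open SeriesInX R M using (0<M; inX-step; inX-cong)
  open KernelIdentity R k (suc (suc ℓ₂)) M public using (a)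
  open KernelIdentity R k (suc (suc ℓ₂)) M using (kernel-identity)
  open KernelRoots R isField char0 k (suc ℓ₂) M 0<M public using (ℓ)
  open KernelRoots R isField char0 k (suc ℓ₂) M 0<M using (IsSolution; module Solution; module SolutionPair)
  open CommutativeRingIdentities seriesRing
  open RightHandSide R using (RHS≋)
  open import Algebra.Properties.Monoid.Sum 𝕊.*-monoid using () renaming (sum to product; sum-cong-≋ to product-cong)
  open IntegerRingSolver seriesRing using (solve; _:=_; _:+_; _:*_; _:-_; :-_)
  open ≋-Reasoning
  open import Data.Nat.Divisibility using (divides)

  F≋𝟏+Xa₁ : Fₛ R k ℓ M ≋ 𝟏 +ₚ X *ₚ a 1
  F≋𝟏+Xa₁ = ≋-trans (inX-step (f k ℓ)) (+ₚ-cong (κ-cong (+-identityʳ 1#))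
    (*ₚ-cong (≋-refl {X}) (inX-cong (BoundaryRegion.f≡sum-columnEntries k (suc ℓ₂) (s≤s z≤n)))))

  IsRoot⇒IsSolution : ∀ {w} → IsRoot R k ℓ M w → IsSolution w
  IsRoot⇒IsSolution {w} root n = ≡.subst₂ (λ A B → A n ≈ (X *ₚ B) n) (powₛ≡^ₚ (w -ₚ 𝟏) ℓ) (powₛ≡^ₚ w (k ℕ.+ ℓ)) (root n)

  kernelPolynomial : Vec (PS R) ℓ
  kernelPolynomial = map (λ d → -ₚ (X *ₚ d)) (remainderCoeffs ℓ a)

  kernelPolynomial-root : ∀ {w} → IsSolution w → evalMonic kernelPolynomial (w -ₚ 𝟏) ≋ 𝟎
  kernelPolynomial-root {w} sol = begin
    evalMonic kernelPolynomial (w -ₚ 𝟏)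
      ≈⟨ evalMonic-negate-scale X (remainderCoeffs ℓ a) (w -ₚ 𝟏) ⟩
    (w -ₚ 𝟏) ^ₚ ℓ -ₚ X *ₚ eval (remainderCoeffs ℓ a) (w -ₚ 𝟏)
      ≈⟨ +ₚ-cong (≋-refl {(w -ₚ 𝟏) ^ₚ ℓ}) (-ₚ-cong (*ₚ-cong (≋-refl {X}) (remainder≈eval-remainderCoeffs ℓ a w))) ⟨
    (w -ₚ 𝟏) ^ₚ ℓ -ₚ X *ₚ remainder ℓ a w
      ≈⟨ kernel-identity w sol ⟩
    𝟎 ∎

  kernelPolynomial-coeff₀ : coeff₀ kernelPolynomial ≋ -ₚ (X *ₚ a 0)
  kernelPolynomial-coeff₀ = 𝕊.reflexive
    (≡.trans (coeff₀-map _ (remainderCoeffs ℓ a)) (≡.cong (λ d → -ₚ (X *ₚ d)) (head-remainderCoeffs (suc ℓ₂) a)))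

  kernelPolynomial-coeff₁ : coeff₁ kernelPolynomial ≋ -ₚ (X *ₚ (ι (suc ℓ₂) *ₚ a 0 +ₚ a 1))
  kernelPolynomial-coeff₁ = ≋-trans (𝕊.reflexive (coeff₁-map _ (remainderCoeffs ℓ a)))
    (-ₚ-cong (*ₚ-cong (≋-refl {X}) (≋-trans (second-remainderCoeffs ℓ₂ a) (+ₚ-cong (×ₚ≋ι*ₚ (suc ℓ₂) (a 0)) (≋-refl {a 1})))))

  module _ (w : Fin ℓ → PS R) (distinct : ∀ i j → ¬ (i ≡ j) → ¬ (w i ≋ w j)) (roots : ∀ i → IsRoot R k ℓ M (w i)) where

    z : Fin ℓ → PS R
    z r = w r -ₚ 𝟏

    -- any single root forces ℓ ∣ M, which puts all roots on the same scale tᵐ, M = m ℓ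
    root-differences-cancel : CancellativeDifferences z
    root-differences-cancel r s r≢s q [zr-zs]q≋𝟎 with Solution.ℓ∣M (w fzero) (IsRoot⇒IsSolution (roots fzero))
    ... | divides m M≡mℓ = SolutionPair.distinct⇒cancellative m M≡mℓ (w r) (w s)
      (IsRoot⇒IsSolution (roots r)) (IsRoot⇒IsSolution (roots s)) (distinct r s r≢s) q
      (≋-trans (*ₚ-cong (solve 3 (λ x y o → x :- y := (x :- o) :- (y :- o)) 𝕊.refl (w r) (w s) 𝟏) (≋-refl {q})) [zr-zs]q≋𝟎)

    z-roots : ∀ r → evalMonic kernelPolynomial (z r) ≋ 𝟎
    z-roots r = kernelPolynomial-root (IsRoot⇒IsSolution (roots r))

    1-w≋-z : ∀ j → 𝟏 -ₚ w j ≋ -ₚ z j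
    1-w≋-z j = solve 2 (λ o x → o :- x := :- (x :- o)) 𝕊.refl 𝟏 (w j)

    product[1-w] : product (λ j → 𝟏 -ₚ w j) ≋ -ₚ (X *ₚ a 0)
    product[1-w] = ≋-trans (product-cong 1-w≋-z)
      (≋-trans (≋-sym (vieta₀ kernelPolynomial z z-roots root-differences-cancel)) kernelPolynomial-coeff₀)

    ∑∏-except[1-w] : ∑∏-except (λ j → 𝟏 -ₚ w j) ≋ -ₚ (X *ₚ (ι (suc ℓ₂) *ₚ a 0 +ₚ a 1))
    ∑∏-except[1-w] = ≋-trans (∑∏-except-cong 1-w≋-z)
      (≋-trans (≋-sym (vieta₁ kernelPolynomial z z-roots root-differences-cancel)) kernelPolynomial-coeff₁)

    RHS≋𝟏+Xa₁ : RHS R ℓ w ≋ 𝟏 +ₚ X *ₚ a 1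
    RHS≋𝟏+Xa₁ = begin
      RHS R ℓ w
        ≈⟨ RHS≋ ℓ w ⟩
      (𝟏 +ₚ ι (suc ℓ₂) *ₚ product (λ j → 𝟏 -ₚ w j)) -ₚ ∑∏-except (λ j → 𝟏 -ₚ w j)
        ≈⟨ +ₚ-cong (+ₚ-cong (≋-refl {𝟏}) (*ₚ-cong (≋-refl {ι (suc ℓ₂)}) product[1-w])) (-ₚ-cong ∑∏-except[1-w]) ⟩
      (𝟏 +ₚ ι (suc ℓ₂) *ₚ -ₚ (X *ₚ a 0)) -ₚ -ₚ (X *ₚ (ι (suc ℓ₂) *ₚ a 0 +ₚ a 1))
        ≈⟨ solve 5 (λ o n x a₀ a₁ → (o :+ n :* (:- (x :* a₀))) :- (:- (x :* (n :* a₀ :+ a₁))) := o :+ x :* a₁) 𝕊.refl 𝟏 (ι (suc ℓ₂)) X (a 0) (a 1) ⟩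
      𝟏 +ₚ X *ₚ a 1 ∎

corollary5p2 : {c ℓr : Level} (R : CommutativeRing c ℓr) →
    IsFieldR R → CharZero R → AlgClosed R →
    (k ℓ : ℕ) → 1 ≤ k → 2 ≤ ℓ →
    (M : ℕ) .{{_ : NonZero M}} →
    (w : Fin ℓ → PS R) →
    (∀ i j → ¬ (i ≡ j) → ¬ (_≈ₛ_ R (w i) (w j))) →
    (∀ i → IsRoot R k ℓ M (w i)) →
    _≈ₛ_ R (Fₛ R k ℓ M) (RHS R ℓ w)
corollary5p2 R isField char0 _ k (suc (suc ℓ₂)) _ (s≤s (s≤s z≤n)) M w distinct roots = begin
  Fₛ R k ℓ M     ≈⟨ F≋𝟏+Xa₁ ⟩
  𝟏 +ₚ X *ₚ a 1  ≈⟨ RHS≋𝟏+Xa₁ w distinct roots ⟨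
  RHS R ℓ w      ∎
  where
  open PowerSeries R using (𝟏; _+ₚ_; _*ₚ_; module ≋-Reasoning)
  open ≋-Reasoning
  open KernelMethod R isField char0 k ℓ₂ M
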